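{- Let $\boldsymbol n,\boldsymbol m$ be type sequences with $\boldsymbol m\le\boldsymbol n$ and $m>n/2$, where $m=\sum_im_i$ and $n=\sum_in_i$. Then \[|\mathscr{C}^{\boldsymbol m}_{\boldsymbol n}|=\binom{\boldsymbol n}{\boldsymbol m}|\mathscr{C}^c_{\boldsymbol m}|\,|\mathscr{C}_{\boldsymbol n-\boldsymbol m}|\qquad\text{and}\qquad |\mathscr{S}^{\boldsymbol m}_{\boldsymbol n}|=\binom{\boldsymbol n}{\boldsymbol m}|\mathscr{S}^c_{\boldsymbol m}|\,|\mathscr{S}_{\boldsymbol n-\boldsymbol m}|.\]
   Context: A type sequence $\boldsymbol m=(m_i)_{i\ge1}$ is a sequence of nonnegative integers with $\sum_im_i<\infty$; its vertex set is $[m]$, vertex $j$ of degree $d'_j=\min\{k:\sum_{i\le k}m_i\ge j\}$. $\mathscr{C}_{\boldsymbol m}$ is the set of perfect matchings (configurations) of $\{(j,h):j\in[m],h\in[d'_j]\}$ (empty if $\sum_iim_i$ is odd); each yields a multigraph on $[m]$ with one edge per matched pair, whose components are the components of the configuration; the type of a component is the sequence counting its vertices of each degree. $\mathscr{C}^c_{\boldsymbol m}$: connected configurations; $\mathscr{S}_{\boldsymbol m}$: configurations without self-loops and multiple edges; $\mathscr{S}^c_{\boldsymbol m}=\mathscr{S}_{\boldsymbol m}\cap\mathscr{C}^c_{\boldsymbol m}$. $\mathscr{C}^{\boldsymbol m}_{\boldsymbol n}$ (resp. $\mathscr{S}^{\boldsymbol m}_{\boldsymbol n}$) is the set of configurations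 in $\mathscr{C}_{\boldsymbol n}$ (resp. $\mathscr{S}_{\boldsymbol n}$) having a component of type $\boldsymbol m$. $\boldsymbol m\le\boldsymbol n$ means $m_i\le n_i$ for all $i$; $\binom{\boldsymbol n}{\boldsymbol m}=\prod_i\binom{n_i}{m_i}$. -}

module Defs where

open import Data.Nat using (ℕ; zero; suc; _+_; _*_; _∸_; _≟_; _≤_)
open import Data.Nat.Combinatorics using (_C_)
open import Data.Bool using (Bool; _∨_)
open import Data.Fin as Fin using (Fin; zero; suc; toℕ; splitAt)
open import Data.Fin.Properties using (all?; any?) renaming (_≟_ to _≟ᶠ_)
open import Data.Fin.Subset using (Subset; ⁅_⁆; _∈_)
open import Data.Fin.Subset.Properties using (_∈?_)
open import Data.List as List using (List; []; _∷_; _++_; replicate; length; filter; concatMap; map; allFin)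
open import Data.Nat.ListAction using (sum)
open import Data.Vec as Vec using (Vec; []; _∷_; tabulate; zipWith)
import Data.Vec.Properties as VecP
open import Data.Product using (_×_; ∃; _,_)
open import Data.Product.Properties using ()
open import Data.Sum using (inj₁; inj₂)
open import Relation.Nullary using (Dec; ¬_; yes; no)
open import Relation.Nullary.Decidable using (⌊_⌋; _×-dec_; _→-dec_; ¬?)
open import Relation.Unary using (Pred; Decidable)
open import Relation.Binary.PropositionalEquality using (_≡_; _≢_)
open import Function using (id)

-- A type sequence (m_i)_{i ≥ 1} with finite support is represented by a
-- vector  m : Vec ℕ K  (for any K beyond the support), entry number i
-- (i : Fin K) being m_{i+1}; all m_i with i > K are 0.

TypeSeq : ℕ → Set
TypeSeq K = Vec ℕ K

size : ∀ {K} → TypeSeq K → ℕ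
size = Vec.sum

_≤ᵗ_ : ∀ {K} → TypeSeq K → TypeSeq K → Set
m ≤ᵗ n = ∀ i → Vec.lookup m i ≤ Vec.lookup n i

_-ᵗ_ : ∀ {K} → TypeSeq K → TypeSeq K → TypeSeq K
n -ᵗ m = zipWith _∸_ n m

binomᵗ : ∀ {K} → TypeSeq K → TypeSeq K → ℕ
binomᵗ []       []       = 1
binomᵗ (a ∷ as) (b ∷ bs) = (a C b) * binomᵗ as bs

-- Vertices, degrees, points.
-- degList m = (d'_1, ..., d'_m): m_1 copies of 1, then m_2 copies of 2, ...
-- (vertex j has degree min{k : Σ_{i≤k} m_i ≥ j}).

degList : ∀ {K} → TypeSeq K → List ℕ
degList []       = []
degList (x ∷ xs) = replicate x 1 ++ map suc (degList xs)

Vtx : ∀ {K} → TypeSeq K → Set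
Vtx m = Fin (length (degList m))

deg : ∀ {K} (m : TypeSeq K) → Vtx m → ℕ
deg m = List.lookup (degList m)

#pts : ∀ {K} → TypeSeq K → ℕ
#pts m = sum (degList m)

-- the points (j,h), h ∈ [d'_j], enumerated vertex by vertex:
-- the first d'_1 points belong to vertex 1, the next d'_2 to vertex 2, ...
vertexOfL : (ds : List ℕ) → Fin (sum ds) → Fin (length ds)
vertexOfL []       ()
vertexOfL (d ∷ ds) p with splitAt d p
... | inj₁ _ = zero
... | inj₂ q = suc (vertexOfL ds q)

Pt : ∀ {K} → TypeSeq K → Set
Pt m = Fin (#pts m)

vertexOf : ∀ {K} (m : TypeSeq K) → Pt m → Vtx m
vertexOf m = vertexOfL (degList m)

-- Configurations: a perfect matching of the points is encoded by its
-- (unique) fixed-point-free involution  f : Pt m → Pt m  (p is matched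
-- with f p).  Each matched pair {p, f p} is an edge between
-- vertexOf p and vertexOf (f p).

IsConfig : ∀ {K} (m : TypeSeq K) → Pred (Pt m → Pt m) _
IsConfig m f = ∀ p → (f p ≢ p) × (f (f p) ≡ p)

isConfig? : ∀ {K} (m : TypeSeq K) → Decidable (IsConfig m)
isConfig? m f = all? λ p → ¬? (f p ≟ᶠ p) ×-dec (f (f p) ≟ᶠ p)

NoLoops : ∀ {K} (m : TypeSeq K) → Pred (Pt m → Pt m) _
NoLoops m f = ∀ p → vertexOf m (f p) ≢ vertexOf m p

-- two distinct pairs {p, f p} ≠ {q, f q} never join the same two vertices
-- (the swapped orientation is covered by taking q := f q)
NoMultiEdges : ∀ {K} (m : TypeSeq K) → Pred (Pt m → Pt m) _
NoMultiEdges m f = ∀ p q → q ≢ p → q ≢ f p →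
  ¬ ((vertexOf m p ≡ vertexOf m q) × (vertexOf m (f p) ≡ vertexOf m (f q)))

IsSimple : ∀ {K} (m : TypeSeq K) → Pred (Pt m → Pt m) _
IsSimple m f = NoLoops m f × NoMultiEdges m f

isSimple? : ∀ {K} (m : TypeSeq K) → Decidable (IsSimple m)
isSimple? m f =
  (all? λ p → ¬? (vertexOf m (f p) ≟ᶠ vertexOf m p))
  ×-dec
  (all? λ p → all? λ q →
     ¬? (q ≟ᶠ p) →-dec (¬? (q ≟ᶠ f p) →-dec
         ¬? ((vertexOf m p ≟ᶠ vertexOf m q) ×-dec
              (vertexOf m (f p) ≟ᶠ vertexOf m (f q)))))

-- Components.  step S adds to S every neighbour of a vertex of S;
-- comp f v = step^(#vertices) ⁅ v ⁆ is the vertex set of the component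
-- of v (a path between two vertices has < #vertices edges).

step : ∀ {K} (m : TypeSeq K) → (Pt m → Pt m) → Subset (length (degList m)) → Subset (length (degList m))
step m f S = tabulate λ u → Vec.lookup S u ∨
  ⌊ any? (λ p → (vertexOf m p ∈? S) ×-dec (vertexOf m (f p) ≟ᶠ u)) ⌋

iter : ∀ {A : Set} → ℕ → (A → A) → A → A
iter zero    g a = a
iter (suc k) g a = g (iter k g a)

comp : ∀ {K} (m : TypeSeq K) → (Pt m → Pt m) → Vtx m → Subset (length (degList m))
comp m f v = iter (length (degList m)) (step m f) ⁅ v ⁆

IsConnected : ∀ {K} (m : TypeSeq K) → Pred (Pt m → Pt m) _
IsConnected m f = ∀ u v → u ∈ comp m f v

isConnected? : ∀ {K} (m : TypeSeq K) → Decidable (IsConnected m)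
isConnected? m f = all? λ u → all? λ v → u ∈? comp m f v

-- the type of a vertex set S: entry i (i : Fin K) counts the vertices of
-- S of degree i+1.  (All degrees are ≤ K, so nothing is lost.)
typeOf : ∀ {K} (m : TypeSeq K) → Subset (length (degList m)) → TypeSeq K
typeOf m S = tabulate λ i →
  length (filter (λ u → (u ∈? S) ×-dec (deg m u ≟ suc (toℕ i)))
                 (allFin (length (degList m))))

HasComponentOfType : ∀ {K} (t m : TypeSeq K) → Pred (Pt m → Pt m) _
HasComponentOfType t m f = ∃ λ v → typeOf m (comp m f v) ≡ t

hasComponentOfType? : ∀ {K} (t m : TypeSeq K) → Decidable (HasComponentOfType t m)
hasComponentOfType? t m f = any? λ v → VecP.≡-dec _≟_ (typeOf m (comp m f v)) t

-- Counting.  allFuns n k lists every function Fin n → Fin k exactly once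
-- (up to pointwise equality); #[ P ] counts those satisfying P.

allFuns : ∀ n k → List (Fin n → Fin k)
allFuns zero    k = (λ ()) ∷ []
allFuns (suc n) k = concatMap (λ i → map (λ g → λ { zero → i ; (suc x) → g x }) (allFuns n k)) (allFin k)

count : ∀ N {P : Pred (Fin N → Fin N) Agda.Primitive.lzero} → Decidable P → ℕ
count N P? = length (filter P? (allFuns N N))

#C : ∀ {K} → TypeSeq K → ℕ
#C m = count (#pts m) (isConfig? m)

#Cc : ∀ {K} → TypeSeq K → ℕ
#Cc m = count (#pts m) (λ f → isConfig? m f ×-dec isConnected? m f)

#S : ∀ {K} → TypeSeq K → ℕ
#S m = count (#pts m) (λ f → isConfig? m f ×-dec isSimple? m f)

#Sc : ∀ {K} → TypeSeq K → ℕ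
#Sc m = count (#pts m) (λ f → (isConfig? m f ×-dec isSimple? m f) ×-dec isConnected? m f)

#Cwith : ∀ {K} → TypeSeq K → TypeSeq K → ℕ
#Cwith n t = count (#pts n) (λ f → isConfig? n f ×-dec hasComponentOfType? t n f)

#Swith : ∀ {K} → TypeSeq K → TypeSeq K → ℕ
#Swith n t = count (#pts n) (λ f → (isConfig? n f ×-dec isSimple? n f) ×-dec hasComponentOfType? t n f)

{-# OPTIONS --safe #-}
-- A vertex set of type m has Σᵢ mᵢ > n/2 vertices, so any two such sets meet; hence a
-- configuration has at most one component of type m.  Counting configurations of type n with
-- a component of type m therefore amounts to summing, over the binomᵗ n m vertex sets S of
-- type m, the number of configurations having S as a component.  Cutting along S is a
-- bijection between those and pairs (connected configuration on S, configuration on the rest),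
-- whose degree sequences are m and n - m.  Pairings, simplicity and connectedness all
-- transfer along the cut, which gives both identities at once.

module Submission where

open import Level using (0ℓ)
open import Data.Bool using (Bool; true; false; _∨_; T)
import Data.Bool as Bool
open import Data.Bool.Properties using (T-≡; T-∨)
open import Data.Nat using (ℕ; zero; suc; _+_; _*_; _∸_; _≤_; _<_; z≤n; s≤s; _≟_)
open import Data.Nat.Properties using (+-commutativeSemigroup; +-assoc; *-distribˡ-+; *-distribʳ-+; *-zeroʳ; *-identityʳ; +-identityʳ; *-assoc; suc-injective; ≤-trans; ≤-antisym; ≤-total; ≤-reflexive; m≤n⇒m≤1+n; n≤1+n; m∸n+n≡m; +-monoʳ-≤; m+[n∸m]≡n; <⇒≱; <⇒≢; n≮0)
open import Algebra.Properties.CommutativeSemigroup +-commutativeSemigroup using (interchange)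
open import Data.Nat.Combinatorics using (_C_; nCk+nC[k+1]≡[n+1]C[k+1])
open import Data.Nat.ListAction using (sum)
open import Data.Fin using (Fin; zero; suc; toℕ; splitAt; _↑ˡ_; _↑ʳ_)
open import Data.Fin.Properties using (all?; any?; injective⇒≤; splitAt-↑ˡ; splitAt-↑ʳ; splitAt⁻¹-↑ˡ; splitAt⁻¹-↑ʳ) renaming (_≟_ to _≟ᶠ_)
open import Data.Fin.Subset using (Subset; _∈_; _∉_; _⊆_; _⊈_; ⁅_⁆; ∣_∣; ∁)
open import Data.Fin.Subset.Properties using (_∈?_; _⊆?_; x∈⁅x⁆; x∈⁅y⁆⇒x≡y; ⊆-antisym; ∣p∣≤n; ∣p∣≡n⇒p≡⊤; ∈⊤; p⊂q⇒∣p∣<∣q∣; drop-there; ∣∁p∣≡n∸∣p∣; x∉p⇒x∈∁p; p⊆q⇒∣p∣≤∣q∣; nonempty?; Empty-unique; ∣⊥∣≡0)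
open import Data.List using (List; []; _∷_; _++_; map; filter; length; concatMap; cartesianProductWith; cartesianProduct; allFin; replicate)
import Data.List as List
open import Data.List.Properties using (map-tabulate; length-replicate; length-++; length-map)
open import Data.List.Relation.Unary.All using (All; []; _∷_)
import Data.List.Relation.Unary.All as All
open import Data.List.Relation.Unary.All.Properties using (all-filter)
open import Data.List.Relation.Unary.AllPairs using ([]; _∷_)
open import Data.List.Relation.Unary.Any using (index)
import Data.List.Relation.Unary.Any as Any
open import Data.List.Relation.Unary.Any.Properties using (lookup-index)
open import Data.List.Relation.Unary.Unique.Setoid using (Unique)
import Data.List.Relation.Unary.Unique.Setoid.Properties as Uniqueₛ
import Data.List.Relation.Unary.Unique.Propositional.Properties as Uniqueₚ
open import Data.List.Relation.Unary.Enumerates.Setoid using (IsEnumeration)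
import Data.List.Relation.Unary.Enumerates.Setoid.Properties as Enumerates
import Data.List.Membership.Setoid as SetoidMembership
open import Data.List.Membership.Setoid.Properties using (∈-cartesianProductWith⁺; ∈-resp-≈) renaming (∈-filter⁺ to ∈ₛ-filter⁺)
open import Data.List.Membership.Propositional using () renaming (_∈_ to _∈ₚ_)
open import Data.List.Membership.Propositional.Properties using (∈-lookup; ∈-filter⁻; ∈-filter⁺; ∈-allFin; ∈-map⁺; ∈-map⁻; ∈-++⁺ˡ; ∈-++⁺ʳ)
open import Data.Vec using ([]; _∷_; lookup; tabulate; here; there)
open import Data.Vec.Properties using (lookup∘tabulate; []=⇒lookup; lookup⇒[]=; tabulate-cong; tabulate∘lookup; ∷-injective; ∷-injectiveʳ; ≡-dec)
open import Data.Product using (∃; _×_; _,_; proj₁; proj₂)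
import Data.Product as Product
open import Data.Product.Relation.Binary.Pointwise.NonDependent using (_×ₛ_)
open import Data.Sum using (_⊎_; inj₁; inj₂; fromInj₁; fromInj₂)
import Data.Sum as Sum
open import Data.Sum.Properties using (inj₁-injective; inj₂-injective; map-cong)
open import Function using (_∘_; id; _↔_; Inverse; _⇔_; mk⇔; mk↔ₛ′; Equivalence)
open import Relation.Binary using (Setoid; _Respects_)
open import Relation.Nullary using (Dec; yes; no; ¬_; contradiction)
open import Relation.Nullary.Decidable using (⌊_⌋; _×-dec_; _→-dec_; ¬?; map′; toWitness; fromWitness; decidable-stable)
open import Relation.Unary using (Pred; Decidable)
open import Relation.Binary.PropositionalEquality
open ≡-Reasoning

open import Defs using (TypeSeq; size; _≤ᵗ_; _-ᵗ_; binomᵗ; degList; deg; vertexOfL; typeOf; hasComponentOfType?;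
  iter; count; allFuns; #Cwith; #Cc; #C; #Swith; #Sc; #S)

𝟙 : {P : Set} → Dec P → ℕ
𝟙 (yes _) = 1
𝟙 (no _)  = 0

module _ {P : Set} where

  𝟙-yes : (p? : Dec P) → P → 𝟙 p? ≡ 1
  𝟙-yes (yes _) _ = refl
  𝟙-yes (no ¬p) p = contradiction p ¬p

  𝟙-no : (p? : Dec P) → ¬ P → 𝟙 p? ≡ 0
  𝟙-no (yes p) ¬p = contradiction p ¬p
  𝟙-no (no _)  _  = refl

module _ {P Q : Set} where

  𝟙-cong : (p? : Dec P) (q? : Dec Q) → (P → Q) → (Q → P) → 𝟙 p? ≡ 𝟙 q?
  𝟙-cong (yes _) (yes _) _   _   = refl
  𝟙-cong (yes p) (no ¬q) p⇒q _   = contradiction (p⇒q p) ¬q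
  𝟙-cong (no ¬p) (yes q) _   q⇒p = contradiction (q⇒p q) ¬p
  𝟙-cong (no _)  (no _)  _   _   = refl

  𝟙-× : (p? : Dec P) (q? : Dec Q) → 𝟙 (p? ×-dec q?) ≡ 𝟙 p? * 𝟙 q?
  𝟙-× (yes _) (yes _) = refl
  𝟙-× (yes _) (no _)  = refl
  𝟙-× (no _)  (yes _) = refl
  𝟙-× (no _)  (no _)  = refl

𝟙*-cong : {P : Set} (p? : Dec P) {a b : ℕ} → (P → a ≡ b) → 𝟙 p? * a ≡ 𝟙 p? * b
𝟙*-cong (yes p) a≡b = cong (1 *_) (a≡b p)
𝟙*-cong (no _)  _   = refl

∑ : {A : Set} → List A → (A → ℕ) → ℕ
∑ []       F = 0
∑ (x ∷ xs) F = F x + ∑ xs F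

module _ {A : Set} where

  ∑-cong : {F G : A → ℕ} → (∀ x → F x ≡ G x) → ∀ xs → ∑ xs F ≡ ∑ xs G
  ∑-cong F≗G []       = refl
  ∑-cong F≗G (x ∷ xs) = cong₂ _+_ (F≗G x) (∑-cong F≗G xs)

  ∑-cong-All : {F G : A → ℕ} {xs : List A} → All (λ x → F x ≡ G x) xs → ∑ xs F ≡ ∑ xs G
  ∑-cong-All []       = refl
  ∑-cong-All (e ∷ es) = cong₂ _+_ e (∑-cong-All es)

  ∑-zero : {F : A → ℕ} {xs : List A} → All (λ x → F x ≡ 0) xs → ∑ xs F ≡ 0
  ∑-zero []       = refl
  ∑-zero (e ∷ es) = cong₂ _+_ e (∑-zero es)

  ∑-const : ∀ (xs : List A) c → ∑ xs (λ _ → c) ≡ length xs * c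
  ∑-const []       c = refl
  ∑-const (x ∷ xs) c = cong (c +_) (∑-const xs c)

  ∑-++ : ∀ xs ys (F : A → ℕ) → ∑ (xs ++ ys) F ≡ ∑ xs F + ∑ ys F
  ∑-++ []       ys F = refl
  ∑-++ (x ∷ xs) ys F = trans (cong (F x +_) (∑-++ xs ys F)) (sym (+-assoc (F x) _ _))

  ∑-+ : ∀ xs (F G : A → ℕ) → ∑ xs (λ x → F x + G x) ≡ ∑ xs F + ∑ xs G
  ∑-+ []       F G = refl
  ∑-+ (x ∷ xs) F G = trans (cong (F x + G x +_) (∑-+ xs F G)) (interchange (F x) (G x) (∑ xs F) (∑ xs G))

  ∑-*ˡ : ∀ c xs (F : A → ℕ) → ∑ xs (λ x → c * F x) ≡ c * ∑ xs F
  ∑-*ˡ c []       F = sym (*-zeroʳ c)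
  ∑-*ˡ c (x ∷ xs) F = trans (cong (c * F x +_) (∑-*ˡ c xs F)) (sym (*-distribˡ-+ c (F x) _))

  ∑-*ʳ : ∀ c xs (F : A → ℕ) → ∑ xs (λ x → F x * c) ≡ ∑ xs F * c
  ∑-*ʳ c []       F = refl
  ∑-*ʳ c (x ∷ xs) F = trans (cong (F x * c +_) (∑-*ʳ c xs F)) (sym (*-distribʳ-+ c (F x) _))

  length-filter-∑ : {P : Pred A 0ℓ} (P? : Decidable P) (xs : List A) → length (filter P? xs) ≡ ∑ xs (𝟙 ∘ P?)
  length-filter-∑ P? []       = refl
  length-filter-∑ P? (x ∷ xs) with P? x
  ... | yes _ = cong suc (length-filter-∑ P? xs)
  ... | no _  = length-filter-∑ P? xs

  ∑-𝟙-unique : {Q : Pred A 0ℓ} (Q? : Decidable Q) {x₀ : A} {xs : List A} →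
    Unique (setoid A) xs → x₀ ∈ₚ xs → Q x₀ → All (λ x → Q x → x ≡ x₀) xs → ∑ xs (𝟙 ∘ Q?) ≡ 1
  ∑-𝟙-unique {Q = Q} Q? {xs = x ∷ xs} (x∉xs ∷ _) (Any.here refl) Qx₀ (_ ∷ only) =
    cong₂ _+_ (𝟙-yes (Q? x) Qx₀) (∑-zero {F = 𝟙 ∘ Q?} (All.zipWith not-Q (x∉xs , only)))
    where
    not-Q : ∀ {y} → x ≢ y × (Q y → y ≡ x) → 𝟙 (Q? y) ≡ 0
    not-Q {y} (x≢y , Qy⇒y≡x) = 𝟙-no (Q? y) (λ Qy → x≢y (sym (Qy⇒y≡x Qy)))
  ∑-𝟙-unique Q? {xs = x ∷ xs} (x∉xs ∷ xs!) (Any.there x₀∈xs) Qx₀ (Qx⇒x≡x₀ ∷ only) =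
    cong₂ _+_ (𝟙-no (Q? x) (λ Qx → All.lookup x∉xs x₀∈xs (Qx⇒x≡x₀ Qx))) (∑-𝟙-unique Q? xs! x₀∈xs Qx₀ only)

∑-map : {A B : Set} (g : A → B) (xs : List A) (F : B → ℕ) → ∑ (map g xs) F ≡ ∑ xs (F ∘ g)
∑-map g []       F = refl
∑-map g (x ∷ xs) F = cong (F (g x) +_) (∑-map g xs F)

module _ {A B : Set} where

  ∑-comm : ∀ xs ys (F : A → B → ℕ) → ∑ xs (λ x → ∑ ys (F x)) ≡ ∑ ys (λ y → ∑ xs (λ x → F x y))
  ∑-comm []       ys F = sym (∑-zero (All.universal (λ _ → refl) ys))
  ∑-comm (x ∷ xs) ys F = trans (cong (∑ ys (F x) +_) (∑-comm xs ys F)) (sym (∑-+ ys (F x) _))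

  ∑-product : ∀ xs ys (F : A → ℕ) (G : B → ℕ) → ∑ xs (λ x → ∑ ys (λ y → F x * G y)) ≡ ∑ xs F * ∑ ys G
  ∑-product xs ys F G = trans (∑-cong (λ x → ∑-*ˡ (F x) ys G) xs) (∑-*ʳ (∑ ys G) xs F)

  ∑-cartesianProduct : ∀ xs ys (F : A × B → ℕ) → ∑ (cartesianProduct xs ys) F ≡ ∑ xs (λ x → ∑ ys (λ y → F (x , y)))
  ∑-cartesianProduct []       ys F = refl
  ∑-cartesianProduct (x ∷ xs) ys F = begin
    ∑ (map (x ,_) ys ++ cartesianProduct xs ys) F   ≡⟨ ∑-++ (map (x ,_) ys) _ F ⟩
    ∑ (map (x ,_) ys) F + ∑ (cartesianProduct xs ys) F ≡⟨ cong₂ _+_ (∑-map (x ,_) ys F) (∑-cartesianProduct xs ys F) ⟩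
    ∑ ys (λ y → F (x , y)) + ∑ xs (λ x → ∑ ys (λ y → F (x , y))) ∎

-- Enumerating functions, and counting by injections

concatMap-map : {A B C : Set} (f : A → B → C) (xs : List A) (ys : List B) →
  concatMap (λ x → map (f x) ys) xs ≡ cartesianProductWith f xs ys
concatMap-map f []       ys = refl
concatMap-map f (x ∷ xs) ys = cong (map (f x) ys ++_) (concatMap-map f xs ys)

allFuns-unique : ∀ n k → Unique (Fin n →-setoid Fin k) (allFuns n k)
allFuns-unique zero    k = [] ∷ []
allFuns-unique (suc n) k =
  subst (Unique (Fin (suc n) →-setoid Fin k)) (sym (concatMap-map _ (allFin k) (allFuns n k)))
    (Uniqueₛ.cartesianProductWith⁺ (setoid (Fin k)) (Fin n →-setoid Fin k) (Fin (suc n) →-setoid Fin k)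
      _ (λ e → e zero , e ∘ suc) (Uniqueₚ.allFin⁺ k) (allFuns-unique n k))

allFuns-enumerates : ∀ n k → IsEnumeration (Fin n →-setoid Fin k) (allFuns n k)
allFuns-enumerates zero    k f = Any.here (λ ())
allFuns-enumerates (suc n) k f =
  subst (SetoidMembership._∈_ (Fin (suc n) →-setoid Fin k) f) (sym (concatMap-map _ (allFin k) (allFuns n k)))
    (∈-resp-≈ (Fin (suc n) →-setoid Fin k) (λ { zero → refl ; (suc x) → refl })
      (∈-cartesianProductWith⁺ (setoid (Fin k)) (Fin n →-setoid Fin k) (Fin (suc n) →-setoid Fin k)
        (λ { refl g≗h zero → refl ; refl g≗h (suc x) → g≗h x })
        (∈-allFin (f zero)) (allFuns-enumerates n k (f ∘ suc))))

module _ {S T : Setoid 0ℓ 0ℓ} where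

  open Setoid S using () renaming (Carrier to A; _≈_ to _≈₁_; sym to sym₁)
  open Setoid T using () renaming (Carrier to B; _≈_ to _≈₂_; sym to sym₂; trans to trans₂)
  open SetoidMembership T using () renaming (_∈_ to _∈₂_)

  unique-lookup-injective : ∀ {xs} → Unique S xs → ∀ {i j} → List.lookup xs i ≈₁ List.lookup xs j → i ≡ j
  unique-lookup-injective (x∉xs ∷ xs!) {zero}  {zero}  _ = refl
  unique-lookup-injective (x∉xs ∷ xs!) {zero}  {suc j} e = contradiction e (All.lookup x∉xs (∈-lookup j))
  unique-lookup-injective (x∉xs ∷ xs!) {suc i} {zero}  e = contradiction (sym₁ e) (All.lookup x∉xs (∈-lookup i))
  unique-lookup-injective (x∉xs ∷ xs!) {suc i} {suc j} e = cong suc (unique-lookup-injective xs! e)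

  injection⇒length-≤ : (φ : A → B) {xs : List A} {ys : List B} → Unique S xs →
    (∀ {x} → x ∈ₚ xs → φ x ∈₂ ys) → (∀ {x y} → x ∈ₚ xs → y ∈ₚ xs → φ x ≈₂ φ y → x ≈₁ y) →
    length xs ≤ length ys
  injection⇒length-≤ φ {xs} {ys} xs! φ∈ys reflects = injective⇒≤ slot-injective
    where
    slot : Fin (length xs) → Fin (length ys)
    slot i = index (φ∈ys (∈-lookup i))
    φ≈slot : ∀ i → φ (List.lookup xs i) ≈₂ List.lookup ys (slot i)
    φ≈slot i = lookup-index (φ∈ys (∈-lookup i))
    slot-injective : ∀ {i j} → slot i ≡ slot j → i ≡ j
    slot-injective {i} {j} eq = unique-lookup-injective xs! (reflects (∈-lookup i) (∈-lookup j)
      (trans₂ (φ≈slot i) (subst (λ k → List.lookup ys k ≈₂ φ (List.lookup xs j)) (sym eq) (sym₂ (φ≈slot j)))))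

  injection⇒count-≤ : {P : Pred A 0ℓ} {Q : Pred B 0ℓ} (P? : Decidable P) (Q? : Decidable Q) → Q Respects _≈₂_ →
    (φ : A → B) → (∀ {x} → P x → Q (φ x)) → (∀ {x y} → P x → P y → φ x ≈₂ φ y → x ≈₁ y) →
    ∀ {xs ys} → Unique S xs → IsEnumeration T ys → length (filter P? xs) ≤ length (filter Q? ys)
  injection⇒count-≤ {P} P? Q? Q-resp φ Qφ reflects {xs} {ys} xs! ys-enum =
    injection⇒length-≤ φ (Uniqueₛ.filter⁺ S P? xs!) φ∈ (λ x∈ y∈ → reflects (satisfies x∈) (satisfies y∈))
    where
    satisfies : ∀ {x} → x ∈ₚ filter P? xs → P x
    satisfies x∈ = proj₂ (∈-filter⁻ P? {xs = xs} x∈)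
    φ∈ : ∀ {x} → x ∈ₚ filter P? xs → φ x ∈₂ filter Q? ys
    φ∈ {x} x∈ = ∈ₛ-filter⁺ T Q? Q-resp (ys-enum (φ x)) (Qφ (satisfies x∈))

length-filter-cartesianProduct : {A B : Set} {P : Pred A 0ℓ} {Q : Pred B 0ℓ} (P? : Decidable P) (Q? : Decidable Q)
  (xs : List A) (ys : List B) →
  length (filter (λ z → P? (proj₁ z) ×-dec Q? (proj₂ z)) (cartesianProduct xs ys))
  ≡ length (filter P? xs) * length (filter Q? ys)
length-filter-cartesianProduct P? Q? xs ys = begin
  length (filter _ (cartesianProduct xs ys))               ≡⟨ length-filter-∑ _ (cartesianProduct xs ys) ⟩
  ∑ (cartesianProduct xs ys) _                             ≡⟨ ∑-cartesianProduct xs ys _ ⟩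
  ∑ xs (λ x → ∑ ys (λ y → 𝟙 (P? x ×-dec Q? y)))            ≡⟨ ∑-cong (λ x → ∑-cong (λ y → 𝟙-× (P? x) (Q? y)) ys) xs ⟩
  ∑ xs (λ x → ∑ ys (λ y → 𝟙 (P? x) * 𝟙 (Q? y)))            ≡⟨ ∑-product xs ys _ _ ⟩
  ∑ xs (𝟙 ∘ P?) * ∑ ys (𝟙 ∘ Q?)                            ≡⟨ cong₂ _*_ (length-filter-∑ P? xs) (length-filter-∑ Q? ys) ⟨
  length (filter P? xs) * length (filter Q? ys)            ∎

module _ {n : ℕ} where

  ∈-tabulate⁺ : ∀ {g : Fin n → Bool} {x} → T (g x) → x ∈ tabulate g
  ∈-tabulate⁺ {g} {x} t = lookup⇒[]= x _ (trans (lookup∘tabulate g x) (Equivalence.to T-≡ t))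

  ∈-tabulate⁻ : ∀ {g : Fin n → Bool} {x} → x ∈ tabulate g → T (g x)
  ∈-tabulate⁻ {g} {x} x∈ = Equivalence.from T-≡ (trans (sym (lookup∘tabulate g x)) ([]=⇒lookup x∈))

  lookup-cong : ∀ {S : Subset n} {x y} → (x ∈ S → y ∈ S) → (y ∈ S → x ∈ S) → lookup S x ≡ lookup S y
  lookup-cong {S} {x} {y} x⇒y y⇒x with lookup S x in eqx | lookup S y in eqy
  ... | true  | true  = refl
  ... | false | false = refl
  ... | true  | false = contradiction (trans (sym eqy) ([]=⇒lookup (x⇒y (lookup⇒[]= x S eqx)))) λ ()
  ... | false | true  = contradiction (trans (sym eqx) ([]=⇒lookup (y⇒x (lookup⇒[]= y S eqy)))) λ ()

  ⊈-witness : ∀ {p q : Subset n} → p ⊈ q → ∃ λ x → x ∈ p × x ∉ q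
  ⊈-witness {p} {q} p⊈q with any? (λ x → (x ∈? p) ×-dec ¬? (x ∈? q))
  ... | yes w  = w
  ... | no ¬w = contradiction (λ {x} x∈p → decidable-stable (x ∈? q) (λ x∉q → ¬w (x , x∈p , x∉q))) p⊈q

  nonempty : (S : Subset n) → 0 < ∣ S ∣ → ∃ (_∈ S)
  nonempty S 0<∣S∣ with nonempty? S
  ... | yes S≠∅ = S≠∅
  ... | no  S=∅ = contradiction (trans (cong ∣_∣ (Empty-unique S=∅)) (∣⊥∣≡0 n)) (<⇒≢ 0<∣S∣ ∘ sym)

  large-subsets-meet : (S S' : Subset n) → n < ∣ S ∣ + ∣ S' ∣ → ∃ λ w → w ∈ S × w ∈ S'
  large-subsets-meet S S' n<∣S∣+∣S'∣ with any? (λ w → (w ∈? S) ×-dec (w ∈? S'))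
  ... | yes common = common
  ... | no  none   = contradiction ∣S∣+∣S'∣≤n (<⇒≱ n<∣S∣+∣S'∣)
    where
    S'⊆∁S : S' ⊆ ∁ S
    S'⊆∁S {x} x∈S' = x∉p⇒x∈∁p (λ x∈S → none (x , x∈S , x∈S'))
    ∣S∣+∣S'∣≤n : ∣ S ∣ + ∣ S' ∣ ≤ n
    ∣S∣+∣S'∣≤n = ≤-trans (+-monoʳ-≤ ∣ S ∣ (p⊆q⇒∣p∣≤∣q∣ S'⊆∁S))
                         (≤-reflexive (trans (cong (∣ S ∣ +_) (∣∁p∣≡n∸∣p∣ S)) (m+[n∸m]≡n (∣p∣≤n S))))

module _ {n : ℕ} (F : Subset n → Subset n)
         (inflationary : ∀ {S} → S ⊆ F S) (monotone : ∀ {S S'} → S ⊆ S' → F S ⊆ F S') where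

  iter-mono : ∀ S {k k'} → k ≤ k' → iter k F S ⊆ iter k' F S
  iter-mono S {k} {k'} k≤k' = subst (λ j → iter k F S ⊆ iter j F S) (m∸n+n≡m k≤k') (after (k' ∸ k))
    where
    after : ∀ d → iter k F S ⊆ iter (d + k) F S
    after zero    = id
    after (suc d) = inflationary ∘ after d

  iter-stable : ∀ S i → iter (suc i) F S ⊆ iter i F S → ∀ d → iter (d + i) F S ⊆ iter i F S
  iter-stable S i fix zero    = id
  iter-stable S i fix (suc d) = fix ∘ monotone (iter-stable S i fix d)

  fixed-or-growing : ∀ S j → (∃ λ i → i ≤ j × iter (suc i) F S ⊆ iter i F S) ⊎ j ≤ ∣ iter j F S ∣
  fixed-or-growing S zero = inj₂ z≤n
  fixed-or-growing S (suc j) with fixed-or-growing S j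
  ... | inj₁ (i , i≤j , fix) = inj₁ (i , m≤n⇒m≤1+n i≤j , fix)
  ... | inj₂ j≤∣Fʲ∣ with iter (suc j) F S ⊆? iter j F S
  ...   | yes fix = inj₁ (j , n≤1+n j , fix)
  ...   | no ¬fix = inj₂ (≤-trans (s≤s j≤∣Fʲ∣) (p⊂q⇒∣p∣<∣q∣ (inflationary , ⊈-witness ¬fix)))

  -- A chain that grows at each of its first n steps has reached ⊤.
  iter-⊆-iterⁿ : ∀ S k → iter k F S ⊆ iter n F S
  iter-⊆-iterⁿ S k with fixed-or-growing S n
  ... | inj₂ n≤∣Fⁿ∣ = λ _ → subst (_ ∈_) (sym (∣p∣≡n⇒p≡⊤ (≤-antisym (∣p∣≤n (iter n F S)) n≤∣Fⁿ∣))) ∈⊤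
  ... | inj₁ (i , i≤n , fix) with ≤-total k i
  ...   | inj₁ k≤i = iter-mono S i≤n ∘ iter-mono S k≤i
  ...   | inj₂ i≤k = iter-mono S i≤n ∘ subst (λ j → iter j F S ⊆ iter i F S) (m∸n+n≡m i≤k) (iter-stable S i fix (k ∸ i))

-- Configurations, reachability and components

IsPairing : {A : Set} → Pred (A → A) 0ℓ
IsPairing f = ∀ p → (f p ≢ p) × (f (f p) ≡ p)

-- For vo = vertexOf m, the deciders pairing?, simple? vo and connected? vo below are definitionally
-- Defs' isConfig? m, isSimple? m and isConnected? m, and componentOf vo is comp m.
pairing? : ∀ {N} → Decidable (IsPairing {Fin N})
pairing? f = all? λ p → ¬? (f p ≟ᶠ p) ×-dec (f (f p) ≟ᶠ p)

module _ {A W : Set} (vo : A → W) where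

  Loopless : Pred (A → A) 0ℓ
  Loopless f = ∀ p → vo (f p) ≢ vo p

  NoParallelEdges : Pred (A → A) 0ℓ
  NoParallelEdges f = ∀ p q → q ≢ p → q ≢ f p → ¬ ((vo p ≡ vo q) × (vo (f p) ≡ vo (f q)))

  Simple : Pred (A → A) 0ℓ
  Simple f = Loopless f × NoParallelEdges f

  data Reach (f : A → A) (v : W) : W → Set where
    start : Reach f v v
    edge  : ∀ p → Reach f v (vo p) → Reach f v (vo (f p))

  module _ {f : A → A} where

    Reach-trans : ∀ {v u w} → Reach f v u → Reach f u w → Reach f v w
    Reach-trans r start      = r
    Reach-trans r (edge p s) = edge p (Reach-trans r s)

    Reach-sym : (∀ p → f (f p) ≡ p) → ∀ {v u} → Reach f v u → Reach f u v
    Reach-sym involutive start      = start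
    Reach-sym involutive (edge p r) =
      Reach-trans (subst (Reach f (vo (f p))) (cong vo (involutive p)) (edge (f p) start)) (Reach-sym involutive r)

  Reach-cong : ∀ {f f'} → (∀ p → f p ≡ f' p) → ∀ {v u} → Reach f v u → Reach f' v u
  Reach-cong f≗f' start      = start
  Reach-cong {f' = f'} f≗f' {v} (edge p r) = subst (Reach f' v) (cong vo (sym (f≗f' p))) (edge p (Reach-cong f≗f' r))

module _ {N V : ℕ} (vo : Fin N → Fin V) where

  simple? : Decidable (Simple vo)
  simple? f =
    (all? λ p → ¬? (vo (f p) ≟ᶠ vo p))
    ×-dec
    (all? λ p → all? λ q →
       ¬? (q ≟ᶠ p) →-dec (¬? (q ≟ᶠ f p) →-dec ¬? ((vo p ≟ᶠ vo q) ×-dec (vo (f p) ≟ᶠ vo (f q)))))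

  edgeInto? : (f : Fin N → Fin N) (S : Subset V) (u : Fin V) → Dec (∃ λ p → vo p ∈ S × vo (f p) ≡ u)
  edgeInto? f S u = any? λ p → (vo p ∈? S) ×-dec (vo (f p) ≟ᶠ u)

  grow : (Fin N → Fin N) → Subset V → Subset V
  grow f S = tabulate λ u → lookup S u ∨ ⌊ edgeInto? f S u ⌋

  componentOf : (Fin N → Fin N) → Fin V → Subset V
  componentOf f v = iter V (grow f) ⁅ v ⁆

  Connected : Pred (Fin N → Fin N) 0ℓ
  Connected f = ∀ u v → u ∈ componentOf f v

  connected? : Decidable Connected
  connected? f = all? λ u → all? λ v → u ∈? componentOf f v

  NoCrossingEdge : Subset V → Pred (Fin N → Fin N) 0ℓ
  NoCrossingEdge S f = ∀ p → lookup S (vo p) ≡ lookup S (vo (f p))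

  ConnectedWithin : Subset V → Pred (Fin N → Fin N) 0ℓ
  ConnectedWithin S f = ∀ u v → u ∈ S → v ∈ S → Reach vo f v u

  IsComponent : Subset V → Pred (Fin N → Fin N) 0ℓ
  IsComponent S f = NoCrossingEdge S f × ConnectedWithin S f

  module _ {f : Fin N → Fin N} where

    Reach-stays : ∀ {S} → NoCrossingEdge S f → ∀ {v u} → v ∈ S → Reach vo f v u → u ∈ S
    Reach-stays no-crossing v∈S start      = v∈S
    Reach-stays no-crossing v∈S (edge p r) =
      lookup⇒[]= _ _ (trans (sym (no-crossing p)) ([]=⇒lookup (Reach-stays no-crossing v∈S r)))

    grow-inflationary : ∀ {S} → S ⊆ grow f S
    grow-inflationary u∈S = ∈-tabulate⁺ (Equivalence.from T-∨ (inj₁ (Equivalence.from T-≡ ([]=⇒lookup u∈S))))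

    ∈-grow⁺ : ∀ {S} p → vo p ∈ S → vo (f p) ∈ grow f S
    ∈-grow⁺ {S} p vo[p]∈S = ∈-tabulate⁺ (Equivalence.from (T-∨ {lookup S (vo (f p))})
      (inj₂ (fromWitness {a? = edgeInto? f S (vo (f p))} (p , vo[p]∈S , refl))))

    ∈-grow⁻ : ∀ {S u} → u ∈ grow f S → u ∈ S ⊎ ∃ λ p → vo p ∈ S × vo (f p) ≡ u
    ∈-grow⁻ {S} {u} u∈ with Equivalence.to T-∨ (∈-tabulate⁻ u∈)
    ... | inj₁ t = inj₁ (lookup⇒[]= u S (Equivalence.to T-≡ t))
    ... | inj₂ t = inj₂ (toWitness t)

    grow-monotone : ∀ {S S'} → S ⊆ S' → grow f S ⊆ grow f S'
    grow-monotone S⊆S' u∈ with ∈-grow⁻ u∈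
    ... | inj₁ u∈S                  = grow-inflationary (S⊆S' u∈S)
    ... | inj₂ (p , vo[p]∈S , refl) = ∈-grow⁺ p (S⊆S' vo[p]∈S)

    iter-grow⇒Reach : ∀ {v u} k → u ∈ iter k (grow f) ⁅ v ⁆ → Reach vo f v u
    iter-grow⇒Reach {v} zero u∈ rewrite x∈⁅y⁆⇒x≡y v u∈ = start
    iter-grow⇒Reach (suc k) u∈ with ∈-grow⁻ u∈
    ... | inj₁ u∈Sₖ                  = iter-grow⇒Reach k u∈Sₖ
    ... | inj₂ (p , vo[p]∈Sₖ , refl) = edge p (iter-grow⇒Reach k vo[p]∈Sₖ)

    Reach⇒iter-grow : ∀ {v u} → Reach vo f v u → ∃ λ k → u ∈ iter k (grow f) ⁅ v ⁆
    Reach⇒iter-grow {v} start = 0 , x∈⁅x⁆ v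
    Reach⇒iter-grow (edge p r) with Reach⇒iter-grow r
    ... | k , vo[p]∈Sₖ = suc k , ∈-grow⁺ p vo[p]∈Sₖ

    componentOf⇒Reach : ∀ {v u} → u ∈ componentOf f v → Reach vo f v u
    componentOf⇒Reach = iter-grow⇒Reach V

    Reach⇒componentOf : ∀ {v u} → Reach vo f v u → u ∈ componentOf f v
    Reach⇒componentOf {v} r with Reach⇒iter-grow r
    ... | k , u∈Sₖ = iter-⊆-iterⁿ (grow f) grow-inflationary grow-monotone ⁅ v ⁆ k u∈Sₖ

    reach? : ∀ v u → Dec (Reach vo f v u)
    reach? v u = map′ componentOf⇒Reach Reach⇒componentOf (u ∈? componentOf f v)

    module _ (involutive : ∀ p → f (f p) ≡ p) where

      componentOf-isComponent : ∀ v → IsComponent (componentOf f v) f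
      componentOf-isComponent v = no-crossing , connected-within
        where
        no-crossing : NoCrossingEdge (componentOf f v) f
        no-crossing p = lookup-cong
          (λ vo[p]∈ → Reach⇒componentOf (edge p (componentOf⇒Reach vo[p]∈)))
          (λ vo[fp]∈ → subst (_∈ componentOf f v) (cong vo (involutive p))
                              (Reach⇒componentOf (edge (f p) (componentOf⇒Reach vo[fp]∈))))
        connected-within : ConnectedWithin (componentOf f v) f
        connected-within u w u∈ w∈ =
          Reach-trans vo (Reach-sym vo involutive (componentOf⇒Reach w∈)) (componentOf⇒Reach u∈)

      isComponent⇒≡componentOf : ∀ {S} → IsComponent S f → ∀ {w} → w ∈ S → S ≡ componentOf f w
      isComponent⇒≡componentOf (no-crossing , connected-within) {w} w∈S = ⊆-antisym
        (λ u∈S → Reach⇒componentOf (connected-within _ w u∈S w∈S))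
        (λ u∈C → Reach-stays no-crossing w∈S (componentOf⇒Reach u∈C))

  isComponent? : ∀ S → Decidable (IsComponent S)
  isComponent? S f =
    (all? λ p → lookup S (vo p) Bool.≟ lookup S (vo (f p)))
    ×-dec
    (all? λ u → all? λ v → (u ∈? S) →-dec ((v ∈? S) →-dec reach? v u))

  module _ {f f' : Fin N → Fin N} (f≗f' : ∀ p → f p ≡ f' p) where

    Connected-cong : Connected f → Connected f'
    Connected-cong connected u v = Reach⇒componentOf (Reach-cong vo f≗f' (componentOf⇒Reach (connected u v)))

    IsComponent-cong : ∀ {S} → IsComponent S f → IsComponent S f'
    IsComponent-cong {S} (no-crossing , connected-within) =
      (λ p → trans (no-crossing p) (cong (lookup S ∘ vo) (f≗f' p))) ,
      (λ u v u∈S v∈S → Reach-cong vo f≗f' (connected-within u v u∈S v∈S))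

record GraphMorphism {A B W W' : Set} (vo : A → W) (f : A → A) (vo' : B → W') (F : B → B) : Set where
  field
    onPoints      : A → B
    onVertices    : W → W'
    vertex-square : ∀ a → onVertices (vo a) ≡ vo' (onPoints a)
    edge-square   : ∀ a → onPoints (f a) ≡ F (onPoints a)

module _ {A B W W' : Set} {vo : A → W} {f : A → A} {vo' : B → W'} {F : B → B}
         (μ : GraphMorphism vo f vo' F) where

  open GraphMorphism μ

  Reach-map : ∀ {v u} → Reach vo f v u → Reach vo' F (onVertices v) (onVertices u)
  Reach-map start            = start
  Reach-map {v} (edge p r) =
    subst (Reach vo' F (onVertices v)) (sym (trans (vertex-square (f p)) (cong vo' (edge-square p))))
      (edge (onPoints p) (subst (Reach vo' F (onVertices v)) (vertex-square p) (Reach-map r)))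

  module _ (injective : ∀ {a a'} → onPoints a ≡ onPoints a' → a ≡ a') where

    IsPairing-reflect : IsPairing F → IsPairing f
    IsPairing-reflect pairing p =
      (λ fp≡p → proj₁ (pairing (onPoints p)) (trans (sym (edge-square p)) (cong onPoints fp≡p))) ,
      injective (trans (edge-square (f p)) (trans (cong F (edge-square p)) (proj₂ (pairing (onPoints p)))))

    Simple-reflect : Simple vo' F → Simple vo f
    Simple-reflect (loopless , no-parallel) =
      (λ p e → loopless (onPoints p) (trans (f-image p) (image e))) ,
      (λ p q q≢p q≢fp (e₁ , e₂) → no-parallel (onPoints p) (onPoints q) (q≢p ∘ injective)
         (λ e → q≢fp (injective (trans e (sym (edge-square p)))))
         (image e₁ , trans (f-image p) (trans (image e₂) (sym (f-image q)))))
      where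
      image : ∀ {a b} → vo a ≡ vo b → vo' (onPoints a) ≡ vo' (onPoints b)
      image {a} {b} e = trans (sym (vertex-square a)) (trans (cong onVertices e) (vertex-square b))
      f-image : ∀ a → vo' (F (onPoints a)) ≡ vo' (onPoints (f a))
      f-image a = cong vo' (sym (edge-square a))

IsPairing-⊎ : {A₁ A₂ : Set} {g : A₁ → A₁} {h : A₂ → A₂} → IsPairing g → IsPairing h → IsPairing (Sum.map g h)
IsPairing-⊎ pairing₁ pairing₂ (inj₁ x) = (proj₁ (pairing₁ x) ∘ inj₁-injective) , cong inj₁ (proj₂ (pairing₁ x))
IsPairing-⊎ pairing₁ pairing₂ (inj₂ y) = (proj₁ (pairing₂ y) ∘ inj₂-injective) , cong inj₂ (proj₂ (pairing₂ y))

module _ {A₁ A₂ W₁ W₂ : Set} {vo₁ : A₁ → W₁} {vo₂ : A₂ → W₂} {g : A₁ → A₁} {h : A₂ → A₂} where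

  inj₁-morphism : GraphMorphism vo₁ g (Sum.map vo₁ vo₂) (Sum.map g h)
  inj₁-morphism = record { onPoints = inj₁ ; onVertices = inj₁ ; vertex-square = λ _ → refl ; edge-square = λ _ → refl }

  inj₂-morphism : GraphMorphism vo₂ h (Sum.map vo₁ vo₂) (Sum.map g h)
  inj₂-morphism = record { onPoints = inj₂ ; onVertices = inj₂ ; vertex-square = λ _ → refl ; edge-square = λ _ → refl }

  Simple-⊎ : Simple vo₁ g → Simple vo₂ h → Simple (Sum.map vo₁ vo₂) (Sum.map g h)
  Simple-⊎ (loopless₁ , no-parallel₁) (loopless₂ , no-parallel₂) = loopless , no-parallel
    where
    loopless : Loopless (Sum.map vo₁ vo₂) (Sum.map g h)
    loopless (inj₁ x) = loopless₁ x ∘ inj₁-injective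
    loopless (inj₂ y) = loopless₂ y ∘ inj₂-injective
    no-parallel : NoParallelEdges (Sum.map vo₁ vo₂) (Sum.map g h)
    no-parallel (inj₁ a) (inj₁ b) b≢a b≢ga (e₁ , e₂) =
      no-parallel₁ a b (b≢a ∘ cong inj₁) (b≢ga ∘ cong inj₁) (inj₁-injective e₁ , inj₁-injective e₂)
    no-parallel (inj₂ a) (inj₂ b) b≢a b≢ha (e₁ , e₂) =
      no-parallel₂ a b (b≢a ∘ cong inj₂) (b≢ha ∘ cong inj₂) (inj₂-injective e₁ , inj₂-injective e₂)
    no-parallel (inj₁ a) (inj₂ b) _ _ (() , _)
    no-parallel (inj₂ a) (inj₁ b) _ _ (() , _)

  Reach-inj₁⁻ : ∀ {a w} → Reach (Sum.map vo₁ vo₂) (Sum.map g h) (inj₁ a) w → ∃ λ b → w ≡ inj₁ b × Reach vo₁ g a b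
  Reach-inj₁⁻ {a} start = a , refl , start
  Reach-inj₁⁻ {a} (edge (inj₁ x) r) with Reach-inj₁⁻ r
  ... | b , vo₁x≡b , r' = vo₁ (g x) , refl , edge x (subst (Reach vo₁ g a) (sym (inj₁-injective vo₁x≡b)) r')
  Reach-inj₁⁻ (edge (inj₂ y) r) with Reach-inj₁⁻ r
  ... | b , () , _

-- Splitting a configuration along a vertex set

isLeft : {A B : Set} → A ⊎ B → Bool
isLeft (inj₁ _) = true
isLeft (inj₂ _) = false

inj₁-fromInj₁ : {A B : Set} {d : B → A} (z : A ⊎ B) → isLeft z ≡ true → inj₁ (fromInj₁ d z) ≡ z
inj₁-fromInj₁ (inj₁ _) _ = refl

inj₂-fromInj₂ : {A B : Set} {d : A → B} (z : A ⊎ B) → isLeft z ≡ false → inj₂ (fromInj₂ d z) ≡ z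
inj₂-fromInj₂ (inj₂ _) _ = refl

isLeft-map : {A B C D : Set} {f : A → C} {g : B → D} (z : A ⊎ B) → isLeft (Sum.map f g z) ≡ isLeft z
isLeft-map (inj₁ _) = refl
isLeft-map (inj₂ _) = refl

-- σ exhibits the graph vo as the disjoint union of vo₁ (on the vertices in S) and vo₂.
record Splitting {N V N₁ V₁ N₂ V₂ : ℕ} (vo : Fin N → Fin V) (S : Subset V)
                 (vo₁ : Fin N₁ → Fin V₁) (vo₂ : Fin N₂ → Fin V₂) : Set where
  field
    points         : Fin N ↔ (Fin N₁ ⊎ Fin N₂)
    vertices       : Fin V ↔ (Fin V₁ ⊎ Fin V₂)
    vertexOf-split : ∀ p → Inverse.to vertices (vo p) ≡ Sum.map vo₁ vo₂ (Inverse.to points p)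
    lookup-split   : ∀ v → lookup S v ≡ isLeft (Inverse.to vertices v)

  open Inverse points public using () renaming
    (to to split; from to join; strictlyInverseˡ to split∘join; strictlyInverseʳ to join∘split)
  open Inverse vertices public using () renaming
    (to to splitᵥ; from to joinᵥ; strictlyInverseˡ to splitᵥ∘joinᵥ; strictlyInverseʳ to joinᵥ∘splitᵥ)

  Decomposes : (Fin N → Fin N) → (Fin N₁ → Fin N₁) → (Fin N₂ → Fin N₂) → Set
  Decomposes f g h = ∀ p → split (f p) ≡ Sum.map g h (split p)

record LocalProperty : Set₁ where
  field
    Holds      : ∀ {N V} → (Fin N → Fin V) → Pred (Fin N → Fin N) 0ℓ
    holds?     : ∀ {N V} (vo : Fin N → Fin V) → Decidable (Holds vo)
    Holds-cong : ∀ {N V} {vo : Fin N → Fin V} {f f'} → (∀ p → f p ≡ f' p) → Holds vo f → Holds vo f'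
    involutive : ∀ {N V} {vo : Fin N → Fin V} {f} → Holds vo f → ∀ p → f (f p) ≡ p
    local      : ∀ {N V N₁ V₁ N₂ V₂} {vo : Fin N → Fin V} {S} {vo₁ : Fin N₁ → Fin V₁} {vo₂ : Fin N₂ → Fin V₂}
                 (σ : Splitting vo S vo₁ vo₂) {f g h} → Splitting.Decomposes σ f g h →
                 Holds vo f ⇔ (Holds vo₁ g × Holds vo₂ h)

module Split {N V N₁ V₁ N₂ V₂ : ℕ} {vo : Fin N → Fin V} {S : Subset V}
             {vo₁ : Fin N₁ → Fin V₁} {vo₂ : Fin N₂ → Fin V₂} (σ : Splitting vo S vo₁ vo₂) where

  open Splitting σ

  split-injective : ∀ {p q} → split p ≡ split q → p ≡ q
  split-injective {p} {q} e = trans (sym (join∘split p)) (trans (cong join e) (join∘split q))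

  join-injective : ∀ {x y} → join x ≡ join y → x ≡ y
  join-injective {x} {y} e = trans (sym (split∘join x)) (trans (cong split e) (split∘join y))

  isLeft-split : ∀ p → lookup S (vo p) ≡ isLeft (split p)
  isLeft-split p = trans (lookup-split (vo p)) (trans (cong isLeft (vertexOf-split p)) (isLeft-map (split p)))

  joinᵥ-inj₁∈S : ∀ a → joinᵥ (inj₁ a) ∈ S
  joinᵥ-inj₁∈S a = lookup⇒[]= _ S (trans (lookup-split _) (cong isLeft (splitᵥ∘joinᵥ (inj₁ a))))

  ∈S⇒inj₁ : ∀ {u} → u ∈ S → ∃ λ a → splitᵥ u ≡ inj₁ a
  ∈S⇒inj₁ {u} u∈S with splitᵥ u in e
  ... | inj₁ a = a , refl
  ... | inj₂ _ with trans (sym ([]=⇒lookup u∈S)) (trans (lookup-split u) (cong isLeft e))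
  ...   | ()

  _⊕_ : (Fin N₁ → Fin N₁) → (Fin N₂ → Fin N₂) → Fin N → Fin N
  g ⊕ h = join ∘ Sum.map g h ∘ split

  ⊕-decomposes : ∀ g h → Decomposes (g ⊕ h) g h
  ⊕-decomposes g h p = split∘join (Sum.map g h (split p))

  -- The fallbacks λ _ → x and λ _ → y only matter if f has an edge between S and its complement.
  restrict₁ : (Fin N → Fin N) → Fin N₁ → Fin N₁
  restrict₁ f x = fromInj₁ (λ _ → x) (split (f (join (inj₁ x))))

  restrict₂ : (Fin N → Fin N) → Fin N₂ → Fin N₂
  restrict₂ f y = fromInj₂ (λ _ → y) (split (f (join (inj₂ y))))

  module _ {f : Fin N → Fin N} {g : Fin N₁ → Fin N₁} {h : Fin N₂ → Fin N₂} (d : Decomposes f g h) where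

    decomposes-join : ∀ x → split (f (join x)) ≡ Sum.map g h x
    decomposes-join x = trans (d (join x)) (cong (Sum.map g h) (split∘join x))

    split-morphism : GraphMorphism vo f (Sum.map vo₁ vo₂) (Sum.map g h)
    split-morphism = record
      { onPoints = split ; onVertices = splitᵥ ; vertex-square = vertexOf-split ; edge-square = d }

    join-morphism : GraphMorphism (Sum.map vo₁ vo₂) (Sum.map g h) vo f
    join-morphism = record
      { onPoints = join ; onVertices = joinᵥ
      ; vertex-square = λ x →
          trans (cong joinᵥ (sym (trans (vertexOf-split (join x)) (cong (Sum.map vo₁ vo₂) (split∘join x)))))
                (joinᵥ∘splitᵥ (vo (join x)))
      ; edge-square = λ x → trans (cong join (sym (decomposes-join x))) (join∘split (f (join x)))
      }

    part₁-morphism : GraphMorphism vo₁ g (Sum.map vo₁ vo₂) (Sum.map g h)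
    part₁-morphism = inj₁-morphism

    part₂-morphism : GraphMorphism vo₂ h (Sum.map vo₁ vo₂) (Sum.map g h)
    part₂-morphism = inj₂-morphism

    decomposes⇒noCrossing : NoCrossingEdge vo S f
    decomposes⇒noCrossing p = begin
      lookup S (vo p)             ≡⟨ isLeft-split p ⟩
      isLeft (split p)            ≡⟨ sym (isLeft-map (split p)) ⟩
      isLeft (Sum.map g h (split p)) ≡⟨ cong isLeft (sym (d p)) ⟩
      isLeft (split (f p))        ≡⟨ sym (isLeft-split (f p)) ⟩
      lookup S (vo (f p))         ∎

    IsPairing-split : IsPairing f ⇔ (IsPairing g × IsPairing h)
    IsPairing-split = mk⇔
      (λ pairing → let pairing-⊎ = IsPairing-reflect join-morphism join-injective pairing in
         IsPairing-reflect part₁-morphism inj₁-injective pairing-⊎ ,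
         IsPairing-reflect part₂-morphism inj₂-injective pairing-⊎)
      (λ (pairing₁ , pairing₂) → IsPairing-reflect split-morphism split-injective (IsPairing-⊎ pairing₁ pairing₂))

    Simple-split : Simple vo f ⇔ (Simple vo₁ g × Simple vo₂ h)
    Simple-split = mk⇔
      (λ simple → let simple-⊎ = Simple-reflect join-morphism join-injective simple in
         Simple-reflect part₁-morphism inj₁-injective simple-⊎ ,
         Simple-reflect part₂-morphism inj₂-injective simple-⊎)
      (λ (simple₁ , simple₂) → Simple-reflect split-morphism split-injective (Simple-⊎ simple₁ simple₂))

    connectedWithin⇒Connected : ConnectedWithin vo S f → Connected vo₁ g
    connectedWithin⇒Connected connected-within a b with Reach-inj₁⁻ (reach-in-parts)
      where
      reach-in-parts : Reach (Sum.map vo₁ vo₂) (Sum.map g h) (inj₁ b) (inj₁ a)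
      reach-in-parts = subst₂ (Reach (Sum.map vo₁ vo₂) (Sum.map g h)) (splitᵥ∘joinᵥ (inj₁ b)) (splitᵥ∘joinᵥ (inj₁ a))
        (Reach-map split-morphism (connected-within _ _ (joinᵥ-inj₁∈S a) (joinᵥ-inj₁∈S b)))
    ... | c , refl , r = Reach⇒componentOf vo₁ r

    Connected⇒connectedWithin : Connected vo₁ g → ConnectedWithin vo S f
    Connected⇒connectedWithin connected u v u∈S v∈S with ∈S⇒inj₁ u∈S | ∈S⇒inj₁ v∈S
    ... | a , u↦a | b , v↦b =
      subst₂ (Reach vo f) (trans (cong joinᵥ (sym v↦b)) (joinᵥ∘splitᵥ v)) (trans (cong joinᵥ (sym u↦a)) (joinᵥ∘splitᵥ u))
        (Reach-map join-morphism (Reach-map part₁-morphism (componentOf⇒Reach vo₁ (connected a b))))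

  noCrossing⇒decomposes : ∀ {f} → NoCrossingEdge vo S f → Decomposes f (restrict₁ f) (restrict₂ f)
  noCrossing⇒decomposes {f} no-crossing p = trans (cong (split ∘ f) (sym (join∘split p))) (on-parts (split p))
    where
    same-side : ∀ x → isLeft (split (f (join x))) ≡ isLeft x
    same-side x = begin
      isLeft (split (f (join x)))  ≡⟨ sym (isLeft-split (f (join x))) ⟩
      lookup S (vo (f (join x)))   ≡⟨ sym (no-crossing (join x)) ⟩
      lookup S (vo (join x))       ≡⟨ isLeft-split (join x) ⟩
      isLeft (split (join x))      ≡⟨ cong isLeft (split∘join x) ⟩
      isLeft x                     ∎
    on-parts : ∀ x → split (f (join x)) ≡ Sum.map (restrict₁ f) (restrict₂ f) x
    on-parts (inj₁ x) = sym (inj₁-fromInj₁ (split (f (join (inj₁ x)))) (same-side (inj₁ x)))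
    on-parts (inj₂ y) = sym (inj₂-fromInj₂ (split (f (join (inj₂ y)))) (same-side (inj₂ y)))

  decomposes-unique : ∀ {f f' g h} → Decomposes f g h → Decomposes f' g h → ∀ p → f p ≡ f' p
  decomposes-unique d d' p = split-injective (trans (d p) (sym (d' p)))

  module _ {f g g' h h'} (d : Decomposes f g h) (d' : Decomposes f g' h') where

    decomposes-unique₁ : ∀ x → g x ≡ g' x
    decomposes-unique₁ x = inj₁-injective (trans (sym (decomposes-join d (inj₁ x))) (decomposes-join d' (inj₁ x)))

    decomposes-unique₂ : ∀ y → h y ≡ h' y
    decomposes-unique₂ y = inj₂-injective (trans (sym (decomposes-join d (inj₂ y))) (decomposes-join d' (inj₂ y)))

  module Count (Φ : LocalProperty) where

    open LocalProperty Φ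

    Funs₁ Funs₂ PairSetoid : Setoid 0ℓ 0ℓ
    Funs₁      = Fin N₁ →-setoid Fin N₁
    Funs₂      = Fin N₂ →-setoid Fin N₂
    PairSetoid = Funs₁ ×ₛ Funs₂

    open Setoid PairSetoid using () renaming (_≈_ to Pointwise)

    Whole : Pred (Fin N → Fin N) 0ℓ
    Whole f = Holds vo f × IsComponent vo S f

    Parts : Pred ((Fin N₁ → Fin N₁) × (Fin N₂ → Fin N₂)) 0ℓ
    Parts gh = (Holds vo₁ (proj₁ gh) × Connected vo₁ (proj₁ gh)) × Holds vo₂ (proj₂ gh)

    restrict : (Fin N → Fin N) → (Fin N₁ → Fin N₁) × (Fin N₂ → Fin N₂)
    restrict f = restrict₁ f , restrict₂ f

    Whole⇒Parts : ∀ {f} → Whole f → Parts (restrict f)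
    Whole⇒Parts (holds , no-crossing , connected-within) =
      let d = noCrossing⇒decomposes no-crossing
          holds₁ , holds₂ = Equivalence.to (local σ d) holds
      in (holds₁ , connectedWithin⇒Connected d connected-within) , holds₂

    Parts⇒Whole : ∀ {gh} → Parts gh → Whole (proj₁ gh ⊕ proj₂ gh)
    Parts⇒Whole {g , h} ((holds₁ , connected) , holds₂) =
      let d = ⊕-decomposes g h
      in Equivalence.from (local σ d) (holds₁ , holds₂) , decomposes⇒noCrossing d , Connected⇒connectedWithin d connected

    Whole-cong : ∀ {f f'} → (∀ p → f p ≡ f' p) → Whole f → Whole f'
    Whole-cong f≗f' (holds , component) = Holds-cong f≗f' holds , IsComponent-cong vo f≗f' component

    Parts-cong : ∀ {gh gh'} → Pointwise gh gh' → Parts gh → Parts gh'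
    Parts-cong (g≗g' , h≗h') ((holds₁ , connected) , holds₂) =
      (Holds-cong g≗g' holds₁ , Connected-cong vo₁ g≗g' connected) , Holds-cong h≗h' holds₂

    restrict-reflects : ∀ {f f'} → Whole f → Whole f' → Pointwise (restrict f) (restrict f') → ∀ p → f p ≡ f' p
    restrict-reflects {f} {f'} (_ , no-crossing , _) (_ , no-crossing' , _) (g≗g' , h≗h') =
      decomposes-unique (noCrossing⇒decomposes no-crossing) d'
      where
      d' : Decomposes f' (restrict₁ f) (restrict₂ f)
      d' p = trans (noCrossing⇒decomposes no-crossing' p) (map-cong (sym ∘ g≗g') (sym ∘ h≗h') (split p))

    ⊕-reflects : ∀ {g g' h h'} → (∀ p → (g ⊕ h) p ≡ (g' ⊕ h') p) → Pointwise (g , h) (g' , h')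
    ⊕-reflects {g} {g'} {h} {h'} e =
      decomposes-unique₁ (⊕-decomposes g h) d' , decomposes-unique₂ (⊕-decomposes g h) d'
      where
      d' : Decomposes (g ⊕ h) g' h'
      d' p = trans (cong split (e p)) (⊕-decomposes g' h' p)

    count-split : count N (λ f → holds? vo f ×-dec isComponent? vo S f)
                ≡ count N₁ (λ g → holds? vo₁ g ×-dec connected? vo₁ g) * count N₂ (holds? vo₂)
    count-split = trans (≤-antisym restrict-≤ ⊕-≤)
                        (length-filter-cartesianProduct _ (holds? vo₂) (allFuns N₁ N₁) (allFuns N₂ N₂))
      where
      whole? : Decidable Whole
      whole? f = holds? vo f ×-dec isComponent? vo S f
      parts? : Decidable Parts
      parts? gh = (holds? vo₁ (proj₁ gh) ×-dec connected? vo₁ (proj₁ gh)) ×-dec holds? vo₂ (proj₂ gh)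
      pairs : List ((Fin N₁ → Fin N₁) × (Fin N₂ → Fin N₂))
      pairs = cartesianProduct (allFuns N₁ N₁) (allFuns N₂ N₂)
      restrict-≤ : count N whole? ≤ length (filter parts? pairs)
      restrict-≤ = injection⇒count-≤ {S = Fin N →-setoid Fin N} {T = PairSetoid}
        whole? parts? Parts-cong restrict Whole⇒Parts restrict-reflects (allFuns-unique N N)
        (Enumerates.cartesianProduct⁺ Funs₁ Funs₂ (allFuns-enumerates N₁ N₁) (allFuns-enumerates N₂ N₂))
      ⊕-≤ : length (filter parts? pairs) ≤ count N whole?
      ⊕-≤ = injection⇒count-≤ {S = PairSetoid} {T = Fin N →-setoid Fin N}
        parts? whole? Whole-cong (λ gh → proj₁ gh ⊕ proj₂ gh) Parts⇒Whole (λ _ _ → ⊕-reflects)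
        (Uniqueₛ.cartesianProduct⁺ Funs₁ Funs₂ (allFuns-unique N₁ N₁) (allFuns-unique N₂ N₂))
        (allFuns-enumerates N N)

select : (ds : List ℕ) → Subset (length ds) → List ℕ
select []       []          = []
select (d ∷ ds) (true ∷ S)  = d ∷ select ds S
select (d ∷ ds) (false ∷ S) = select ds S

splitPoints : ∀ ds S → Fin (sum ds) → Fin (sum (select ds S)) ⊎ Fin (sum (select ds (∁ S)))
splitPoints (d ∷ ds) (true ∷ S) p with splitAt d p
... | inj₁ i = inj₁ (i ↑ˡ _)
... | inj₂ q = Sum.map (d ↑ʳ_) id (splitPoints ds S q)
splitPoints (d ∷ ds) (false ∷ S) p with splitAt d p
... | inj₁ i = inj₂ (i ↑ˡ _)
... | inj₂ q = Sum.map id (d ↑ʳ_) (splitPoints ds S q)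

joinPoints : ∀ ds S → Fin (sum (select ds S)) ⊎ Fin (sum (select ds (∁ S))) → Fin (sum ds)
joinPoints [] [] (inj₁ ())
joinPoints [] [] (inj₂ ())
joinPoints (d ∷ ds) (true ∷ S) (inj₁ x) with splitAt d x
... | inj₁ i = i ↑ˡ _
... | inj₂ r = d ↑ʳ joinPoints ds S (inj₁ r)
joinPoints (d ∷ ds) (true ∷ S) (inj₂ y) = d ↑ʳ joinPoints ds S (inj₂ y)
joinPoints (d ∷ ds) (false ∷ S) (inj₁ x) = d ↑ʳ joinPoints ds S (inj₁ x)
joinPoints (d ∷ ds) (false ∷ S) (inj₂ y) with splitAt d y
... | inj₁ i = i ↑ˡ _
... | inj₂ r = d ↑ʳ joinPoints ds S (inj₂ r)

joinPoints∘splitPoints : ∀ ds S p → joinPoints ds S (splitPoints ds S p) ≡ p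
joinPoints∘splitPoints (d ∷ ds) (true ∷ S) p with splitAt d p in eq
... | inj₁ i rewrite splitAt-↑ˡ d i (sum (select ds S)) = splitAt⁻¹-↑ˡ eq
... | inj₂ q with splitPoints ds S q | joinPoints∘splitPoints ds S q
...   | inj₁ r | ih rewrite splitAt-↑ʳ d (sum (select ds S)) r = trans (cong (d ↑ʳ_) ih) (splitAt⁻¹-↑ʳ eq)
...   | inj₂ r | ih = trans (cong (d ↑ʳ_) ih) (splitAt⁻¹-↑ʳ eq)
joinPoints∘splitPoints (d ∷ ds) (false ∷ S) p with splitAt d p in eq
... | inj₁ i rewrite splitAt-↑ˡ d i (sum (select ds (∁ S))) = splitAt⁻¹-↑ˡ eq
... | inj₂ q with splitPoints ds S q | joinPoints∘splitPoints ds S q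
...   | inj₂ r | ih rewrite splitAt-↑ʳ d (sum (select ds (∁ S))) r = trans (cong (d ↑ʳ_) ih) (splitAt⁻¹-↑ʳ eq)
...   | inj₁ r | ih = trans (cong (d ↑ʳ_) ih) (splitAt⁻¹-↑ʳ eq)

splitPoints∘joinPoints : ∀ ds S x → splitPoints ds S (joinPoints ds S x) ≡ x
splitPoints∘joinPoints [] [] (inj₁ ())
splitPoints∘joinPoints [] [] (inj₂ ())
splitPoints∘joinPoints (d ∷ ds) (true ∷ S) (inj₁ x) with splitAt d x in eq
... | inj₁ i rewrite splitAt-↑ˡ d i (sum ds) = cong inj₁ (splitAt⁻¹-↑ˡ eq)
... | inj₂ r rewrite splitAt-↑ʳ d (sum ds) (joinPoints ds S (inj₁ r)) | splitPoints∘joinPoints ds S (inj₁ r) =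
        cong inj₁ (splitAt⁻¹-↑ʳ eq)
splitPoints∘joinPoints (d ∷ ds) (true ∷ S) (inj₂ y)
  rewrite splitAt-↑ʳ d (sum ds) (joinPoints ds S (inj₂ y)) | splitPoints∘joinPoints ds S (inj₂ y) = refl
splitPoints∘joinPoints (d ∷ ds) (false ∷ S) (inj₁ x)
  rewrite splitAt-↑ʳ d (sum ds) (joinPoints ds S (inj₁ x)) | splitPoints∘joinPoints ds S (inj₁ x) = refl
splitPoints∘joinPoints (d ∷ ds) (false ∷ S) (inj₂ y) with splitAt d y in eq
... | inj₁ i rewrite splitAt-↑ˡ d i (sum ds) = cong inj₂ (splitAt⁻¹-↑ˡ eq)
... | inj₂ r rewrite splitAt-↑ʳ d (sum ds) (joinPoints ds S (inj₂ r)) | splitPoints∘joinPoints ds S (inj₂ r) =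
        cong inj₂ (splitAt⁻¹-↑ʳ eq)

splitVertices : ∀ ds S → Fin (length ds) → Fin (length (select ds S)) ⊎ Fin (length (select ds (∁ S)))
splitVertices (d ∷ ds) (true ∷ S)  zero    = inj₁ zero
splitVertices (d ∷ ds) (true ∷ S)  (suc v) = Sum.map suc id (splitVertices ds S v)
splitVertices (d ∷ ds) (false ∷ S) zero    = inj₂ zero
splitVertices (d ∷ ds) (false ∷ S) (suc v) = Sum.map id suc (splitVertices ds S v)

joinVertices : ∀ ds S → Fin (length (select ds S)) ⊎ Fin (length (select ds (∁ S))) → Fin (length ds)
joinVertices [] [] (inj₁ ())
joinVertices [] [] (inj₂ ())
joinVertices (d ∷ ds) (true ∷ S)  (inj₁ zero)    = zero
joinVertices (d ∷ ds) (true ∷ S)  (inj₁ (suc w)) = suc (joinVertices ds S (inj₁ w))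
joinVertices (d ∷ ds) (true ∷ S)  (inj₂ w)       = suc (joinVertices ds S (inj₂ w))
joinVertices (d ∷ ds) (false ∷ S) (inj₁ w)       = suc (joinVertices ds S (inj₁ w))
joinVertices (d ∷ ds) (false ∷ S) (inj₂ zero)    = zero
joinVertices (d ∷ ds) (false ∷ S) (inj₂ (suc w)) = suc (joinVertices ds S (inj₂ w))

joinVertices∘splitVertices : ∀ ds S v → joinVertices ds S (splitVertices ds S v) ≡ v
joinVertices∘splitVertices (d ∷ ds) (true ∷ S) zero = refl
joinVertices∘splitVertices (d ∷ ds) (true ∷ S) (suc v) with splitVertices ds S v | joinVertices∘splitVertices ds S v
... | inj₁ w | ih = cong suc ih
... | inj₂ w | ih = cong suc ih
joinVertices∘splitVertices (d ∷ ds) (false ∷ S) zero = refl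
joinVertices∘splitVertices (d ∷ ds) (false ∷ S) (suc v) with splitVertices ds S v | joinVertices∘splitVertices ds S v
... | inj₁ w | ih = cong suc ih
... | inj₂ w | ih = cong suc ih

splitVertices∘joinVertices : ∀ ds S x → splitVertices ds S (joinVertices ds S x) ≡ x
splitVertices∘joinVertices [] [] (inj₁ ())
splitVertices∘joinVertices [] [] (inj₂ ())
splitVertices∘joinVertices (d ∷ ds) (true ∷ S)  (inj₁ zero)    = refl
splitVertices∘joinVertices (d ∷ ds) (true ∷ S)  (inj₁ (suc w)) rewrite splitVertices∘joinVertices ds S (inj₁ w) = refl
splitVertices∘joinVertices (d ∷ ds) (true ∷ S)  (inj₂ w)       rewrite splitVertices∘joinVertices ds S (inj₂ w) = refl
splitVertices∘joinVertices (d ∷ ds) (false ∷ S) (inj₁ w)       rewrite splitVertices∘joinVertices ds S (inj₁ w) = refl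
splitVertices∘joinVertices (d ∷ ds) (false ∷ S) (inj₂ zero)    = refl
splitVertices∘joinVertices (d ∷ ds) (false ∷ S) (inj₂ (suc w)) rewrite splitVertices∘joinVertices ds S (inj₂ w) = refl

vertexOf-splitPoints : ∀ ds S p →
  splitVertices ds S (vertexOfL ds p) ≡ Sum.map (vertexOfL (select ds S)) (vertexOfL (select ds (∁ S))) (splitPoints ds S p)
vertexOf-splitPoints (d ∷ ds) (true ∷ S) p with splitAt d p
... | inj₁ i rewrite splitAt-↑ˡ d i (sum (select ds S)) = refl
... | inj₂ q with splitPoints ds S q | vertexOf-splitPoints ds S q
...   | inj₁ r | e rewrite splitAt-↑ʳ d (sum (select ds S)) r | e = refl
...   | inj₂ r | e rewrite e = refl
vertexOf-splitPoints (d ∷ ds) (false ∷ S) p with splitAt d p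
... | inj₁ i rewrite splitAt-↑ˡ d i (sum (select ds (∁ S))) = refl
... | inj₂ q with splitPoints ds S q | vertexOf-splitPoints ds S q
...   | inj₂ r | e rewrite splitAt-↑ʳ d (sum (select ds (∁ S))) r | e = refl
...   | inj₁ r | e rewrite e = refl

lookup-splitVertices : ∀ ds S v → lookup S v ≡ isLeft (splitVertices ds S v)
lookup-splitVertices (d ∷ ds) (true ∷ S)  zero    = refl
lookup-splitVertices (d ∷ ds) (true ∷ S)  (suc v) =
  trans (lookup-splitVertices ds S v) (sym (isLeft-map (splitVertices ds S v)))
lookup-splitVertices (d ∷ ds) (false ∷ S) zero    = refl
lookup-splitVertices (d ∷ ds) (false ∷ S) (suc v) =
  trans (lookup-splitVertices ds S v) (sym (isLeft-map (splitVertices ds S v)))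

splitting : ∀ ds S → Splitting (vertexOfL ds) S (vertexOfL (select ds S)) (vertexOfL (select ds (∁ S)))
splitting ds S = record
  { points         = mk↔ₛ′ (splitPoints ds S) (joinPoints ds S)
                             (splitPoints∘joinPoints ds S) (joinPoints∘splitPoints ds S)
  ; vertices       = mk↔ₛ′ (splitVertices ds S) (joinVertices ds S)
                             (splitVertices∘joinVertices ds S) (joinVertices∘splitVertices ds S)
  ; vertexOf-split = vertexOf-splitPoints ds S
  ; lookup-split   = lookup-splitVertices ds S
  }

-- Types of vertex sets

_≟ᵗ_ : ∀ {K} (t t' : TypeSeq K) → Dec (t ≡ t')
_≟ᵗ_ = ≡-dec _≟_

multiplicity : ℕ → List ℕ → ℕ
multiplicity k ds = ∑ ds (λ d → 𝟙 (d ≟ k))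

∑-allFin-suc : ∀ n (F : Fin (suc n) → ℕ) → ∑ (allFin (suc n)) F ≡ F zero + ∑ (allFin n) (F ∘ suc)
∑-allFin-suc n F = cong (F zero +_) (trans (cong (λ xs → ∑ xs F) (sym (map-tabulate id suc))) (∑-map suc (allFin n) F))

∑-replicate : ∀ a (x : ℕ) (F : ℕ → ℕ) → ∑ (replicate a x) F ≡ a * F x
∑-replicate zero    x F = refl
∑-replicate (suc a) x F = cong (F x +_) (∑-replicate a x F)

multiplicity-select : ∀ ds (S : Subset (length ds)) k →
  ∑ (allFin (length ds)) (λ u → 𝟙 ((u ∈? S) ×-dec (List.lookup ds u ≟ k))) ≡ multiplicity k (select ds S)
multiplicity-select []       []      k = refl
multiplicity-select (d ∷ ds) (s ∷ S) k = begin
  ∑ (allFin (suc (length ds))) _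
    ≡⟨ ∑-allFin-suc (length ds) _ ⟩
  𝟙 ((zero ∈? (s ∷ S)) ×-dec (d ≟ k)) + ∑ (allFin (length ds)) _
    ≡⟨ cong (𝟙 ((zero ∈? (s ∷ S)) ×-dec (d ≟ k)) +_) tail ⟩
  𝟙 ((zero ∈? (s ∷ S)) ×-dec (d ≟ k)) + multiplicity k (select ds S)
    ≡⟨ head s ⟩
  multiplicity k (select (d ∷ ds) (s ∷ S)) ∎
  where
  tail : ∑ (allFin (length ds)) (λ u → 𝟙 ((suc u ∈? (s ∷ S)) ×-dec (List.lookup ds u ≟ k))) ≡ multiplicity k (select ds S)
  tail = trans (∑-cong (λ u → 𝟙-cong _ _ (Product.map₁ drop-there) (Product.map₁ there)) (allFin (length ds)))
               (multiplicity-select ds S k)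
  head : ∀ s → 𝟙 ((zero ∈? (s ∷ S)) ×-dec (d ≟ k)) + multiplicity k (select ds S) ≡ multiplicity k (select (d ∷ ds) (s ∷ S))
  head true  = cong (_+ multiplicity k (select ds S)) (𝟙-cong _ (d ≟ k) proj₂ (here ,_))
  head false = cong (_+ multiplicity k (select ds S)) (𝟙-no ((zero ∈? (false ∷ S)) ×-dec (d ≟ k)) λ { (() , _) })

module _ {A : Set} where

  takeˢ : (xs ys : List A) → Subset (length (xs ++ ys)) → Subset (length xs)
  takeˢ []       ys S       = []
  takeˢ (x ∷ xs) ys (s ∷ S) = s ∷ takeˢ xs ys S

  dropˢ : (xs ys : List A) → Subset (length (xs ++ ys)) → Subset (length ys)
  dropˢ []       ys S       = S
  dropˢ (x ∷ xs) ys (s ∷ S) = dropˢ xs ys S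

  castˢ : (f : A → ℕ) (xs : List A) → Subset (length (map f xs)) → Subset (length xs)
  castˢ f []       []      = []
  castˢ f (x ∷ xs) (s ∷ S) = s ∷ castˢ f xs S

  ∣takeˢ∣+∣dropˢ∣ : ∀ xs ys S → ∣ takeˢ xs ys S ∣ + ∣ dropˢ xs ys S ∣ ≡ ∣ S ∣
  ∣takeˢ∣+∣dropˢ∣ []       ys S           = refl
  ∣takeˢ∣+∣dropˢ∣ (x ∷ xs) ys (true ∷ S)  = cong suc (∣takeˢ∣+∣dropˢ∣ xs ys S)
  ∣takeˢ∣+∣dropˢ∣ (x ∷ xs) ys (false ∷ S) = ∣takeˢ∣+∣dropˢ∣ xs ys S

  ∣castˢ∣ : ∀ f xs S → ∣ castˢ f xs S ∣ ≡ ∣ S ∣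
  ∣castˢ∣ f []       []          = refl
  ∣castˢ∣ f (x ∷ xs) (true ∷ S)  = cong suc (∣castˢ∣ f xs S)
  ∣castˢ∣ f (x ∷ xs) (false ∷ S) = ∣castˢ∣ f xs S

  takeˢ-∁ : ∀ xs ys S → takeˢ xs ys (∁ S) ≡ ∁ (takeˢ xs ys S)
  takeˢ-∁ []       ys S       = refl
  takeˢ-∁ (x ∷ xs) ys (s ∷ S) = cong (_ ∷_) (takeˢ-∁ xs ys S)

  dropˢ-∁ : ∀ xs ys S → dropˢ xs ys (∁ S) ≡ ∁ (dropˢ xs ys S)
  dropˢ-∁ []       ys S       = refl
  dropˢ-∁ (x ∷ xs) ys (s ∷ S) = dropˢ-∁ xs ys S

  castˢ-∁ : ∀ f xs S → castˢ f xs (∁ S) ≡ ∁ (castˢ f xs S)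
  castˢ-∁ f []       []      = refl
  castˢ-∁ f (x ∷ xs) (s ∷ S) = cong (_ ∷_) (castˢ-∁ f xs S)

select-++ : ∀ xs ys S → select (xs ++ ys) S ≡ select xs (takeˢ xs ys S) ++ select ys (dropˢ xs ys S)
select-++ []       ys S           = refl
select-++ (x ∷ xs) ys (true ∷ S)  = cong (x ∷_) (select-++ xs ys S)
select-++ (x ∷ xs) ys (false ∷ S) = select-++ xs ys S

select-map-suc : ∀ ds S → select (map suc ds) S ≡ map suc (select ds (castˢ suc ds S))
select-map-suc []       []          = refl
select-map-suc (d ∷ ds) (true ∷ S)  = cong (suc d ∷_) (select-map-suc ds S)
select-map-suc (d ∷ ds) (false ∷ S) = select-map-suc ds S

select-replicate : ∀ a x S → select (replicate a x) S ≡ replicate ∣ S ∣ x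
select-replicate zero    x []          = refl
select-replicate (suc a) x (true ∷ S)  = cong (x ∷_) (select-replicate a x S)
select-replicate (suc a) x (false ∷ S) = select-replicate a x S

module _ {K : ℕ} (a : ℕ) (as : TypeSeq K) where

  headBlock : Subset (length (degList (a ∷ as))) → Subset (length (replicate a 1))
  headBlock = takeˢ (replicate a 1) (map suc (degList as))

  tailBlock : Subset (length (degList (a ∷ as))) → Subset (length (degList as))
  tailBlock = castˢ suc (degList as) ∘ dropˢ (replicate a 1) (map suc (degList as))

-- The type of S computed block by block, along degList (a ∷ as) = replicate a 1 ++ map suc (degList as).
blockType : ∀ {K} (n : TypeSeq K) → Subset (length (degList n)) → TypeSeq K
blockType []       S = []
blockType (a ∷ as) S = ∣ headBlock a as S ∣ ∷ blockType as (tailBlock a as S)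

select-degList : ∀ {K} (n : TypeSeq K) S → select (degList n) S ≡ degList (blockType n S)
select-degList []       [] = refl
select-degList (a ∷ as) S = begin
  select (replicate a 1 ++ map suc (degList as)) S
    ≡⟨ select-++ (replicate a 1) (map suc (degList as)) S ⟩
  select (replicate a 1) (headBlock a as S) ++ select (map suc (degList as)) (dropˢ (replicate a 1) _ S)
    ≡⟨ cong₂ _++_ (select-replicate a 1 (headBlock a as S))
                  (trans (select-map-suc (degList as) _) (cong (map suc) (select-degList as (tailBlock a as S)))) ⟩
  replicate ∣ headBlock a as S ∣ 1 ++ map suc (degList (blockType as (tailBlock a as S)))
    ∎

blockType-∁ : ∀ {K} (n : TypeSeq K) S → blockType n (∁ S) ≡ n -ᵗ blockType n S
blockType-∁ []       [] = refl
blockType-∁ (a ∷ as) S = cong₂ _∷_ head (trans (cong (blockType as) tail) (blockType-∁ as (tailBlock a as S)))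
  where
  head : ∣ headBlock a as (∁ S) ∣ ≡ a ∸ ∣ headBlock a as S ∣
  head = trans (cong ∣_∣ (takeˢ-∁ (replicate a 1) _ S))
               (trans (∣∁p∣≡n∸∣p∣ (headBlock a as S)) (cong (_∸ ∣ headBlock a as S ∣) (length-replicate a)))
  tail : tailBlock a as (∁ S) ≡ ∁ (tailBlock a as S)
  tail = trans (cong (castˢ suc (degList as)) (dropˢ-∁ (replicate a 1) _ S)) (castˢ-∁ suc (degList as) _)

size-blockType : ∀ {K} (n : TypeSeq K) S → size (blockType n S) ≡ ∣ S ∣
size-blockType []       [] = refl
size-blockType (a ∷ as) S = begin
  ∣ headBlock a as S ∣ + size (blockType as (tailBlock a as S))
    ≡⟨ cong (∣ headBlock a as S ∣ +_) (trans (size-blockType as _) (∣castˢ∣ suc (degList as) _)) ⟩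
  ∣ headBlock a as S ∣ + ∣ dropˢ (replicate a 1) (map suc (degList as)) S ∣
    ≡⟨ ∣takeˢ∣+∣dropˢ∣ (replicate a 1) _ S ⟩
  ∣ S ∣ ∎

length-degList : ∀ {K} (n : TypeSeq K) → length (degList n) ≡ size n
length-degList []       = refl
length-degList (a ∷ as) = begin
  length (replicate a 1 ++ map suc (degList as))  ≡⟨ length-++ (replicate a 1) ⟩
  length (replicate a 1) + length (map suc (degList as))
    ≡⟨ cong₂ _+_ (length-replicate a) (trans (length-map suc (degList as)) (length-degList as)) ⟩
  a + size as ∎

multiplicity-map-suc : ∀ k ds → multiplicity (suc k) (map suc ds) ≡ multiplicity k ds
multiplicity-map-suc k ds = trans (∑-map suc ds _) (∑-cong (λ d → 𝟙-cong _ _ suc-injective (cong suc)) ds)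

multiplicity-zero-degList : ∀ {K} (t : TypeSeq K) → multiplicity 0 (degList t) ≡ 0
multiplicity-zero-degList []       = refl
multiplicity-zero-degList (c ∷ cs) = begin
  multiplicity 0 (replicate c 1 ++ map suc (degList cs))             ≡⟨ ∑-++ (replicate c 1) _ _ ⟩
  multiplicity 0 (replicate c 1) + multiplicity 0 (map suc (degList cs))
    ≡⟨ cong₂ _+_ (trans (∑-replicate c 1 _) (*-zeroʳ c))
                 (trans (∑-map suc (degList cs) _) (∑-zero (All.universal (λ d → 𝟙-no (suc d ≟ 0) λ ()) (degList cs)))) ⟩
  0 ∎

multiplicity-degList : ∀ {K} (t : TypeSeq K) i → multiplicity (suc (toℕ i)) (degList t) ≡ lookup t i
multiplicity-degList (c ∷ cs) i = begin
  multiplicity (suc (toℕ i)) (replicate c 1 ++ map suc (degList cs))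
    ≡⟨ ∑-++ (replicate c 1) _ _ ⟩
  multiplicity (suc (toℕ i)) (replicate c 1) + multiplicity (suc (toℕ i)) (map suc (degList cs))
    ≡⟨ cong₂ _+_ (∑-replicate c 1 _) (multiplicity-map-suc (toℕ i) (degList cs)) ⟩
  c * 𝟙 (1 ≟ suc (toℕ i)) + multiplicity (toℕ i) (degList cs)
    ≡⟨ entry i ⟩
  lookup (c ∷ cs) i ∎
  where
  entry : ∀ i → c * 𝟙 (1 ≟ suc (toℕ i)) + multiplicity (toℕ i) (degList cs) ≡ lookup (c ∷ cs) i
  entry zero    = trans (cong₂ _+_ (*-identityʳ c) (multiplicity-zero-degList cs)) (+-identityʳ c)
  entry (suc i) = cong₂ _+_ (*-zeroʳ c) (multiplicity-degList cs i)

typeOf≡blockType : ∀ {K} (n : TypeSeq K) S → typeOf n S ≡ blockType n S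
typeOf≡blockType n S = trans (tabulate-cong entry) (tabulate∘lookup (blockType n S))
  where
  entry : ∀ i → length (filter (λ u → (u ∈? S) ×-dec (deg n u ≟ suc (toℕ i))) (allFin (length (degList n))))
              ≡ lookup (blockType n S) i
  entry i = begin
    length (filter _ (allFin (length (degList n))))
      ≡⟨ length-filter-∑ _ (allFin (length (degList n))) ⟩
    ∑ (allFin (length (degList n))) _
      ≡⟨ multiplicity-select (degList n) S (suc (toℕ i)) ⟩
    multiplicity (suc (toℕ i)) (select (degList n) S)
      ≡⟨ cong (multiplicity (suc (toℕ i))) (select-degList n S) ⟩
    multiplicity (suc (toℕ i)) (degList (blockType n S))
      ≡⟨ multiplicity-degList (blockType n S) i ⟩
    lookup (blockType n S) i ∎

allSubsets : ∀ n → List (Subset n)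
allSubsets zero    = [] ∷ []
allSubsets (suc n) = map (true ∷_) (allSubsets n) ++ map (false ∷_) (allSubsets n)

∈-allSubsets : ∀ {n} (S : Subset n) → S ∈ₚ allSubsets n
∈-allSubsets []          = Any.here refl
∈-allSubsets (true ∷ S)  = ∈-++⁺ˡ (∈-map⁺ (true ∷_) (∈-allSubsets S))
∈-allSubsets (false ∷ S) = ∈-++⁺ʳ (map (true ∷_) (allSubsets _)) (∈-map⁺ (false ∷_) (∈-allSubsets S))

allSubsets-unique : ∀ n → Unique (setoid (Subset n)) (allSubsets n)
allSubsets-unique zero    = [] ∷ []
allSubsets-unique (suc n) =
  Uniqueₚ.++⁺ (Uniqueₚ.map⁺ ∷-injectiveʳ (allSubsets-unique n)) (Uniqueₚ.map⁺ ∷-injectiveʳ (allSubsets-unique n)) disjoint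
  where
  disjoint : ∀ {S} → ¬ (S ∈ₚ map (true ∷_) (allSubsets n) × S ∈ₚ map (false ∷_) (allSubsets n))
  disjoint (∈true , ∈false) with ∈-map⁻ (true ∷_) ∈true | ∈-map⁻ (false ∷_) ∈false
  ... | _ , _ , refl | _ , _ , ()

∑-allSubsets-suc : ∀ n (F : Subset (suc n) → ℕ) →
  ∑ (allSubsets (suc n)) F ≡ ∑ (allSubsets n) (F ∘ (true ∷_)) + ∑ (allSubsets n) (F ∘ (false ∷_))
∑-allSubsets-suc n F =
  trans (∑-++ (map (true ∷_) (allSubsets n)) _ F) (cong₂ _+_ (∑-map _ (allSubsets n) F) (∑-map _ (allSubsets n) F))

∑-allSubsets-++ : {A : Set} (xs ys : List A) (F : Subset (length xs) → Subset (length ys) → ℕ) →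
  ∑ (allSubsets (length (xs ++ ys))) (λ S → F (takeˢ xs ys S) (dropˢ xs ys S))
  ≡ ∑ (allSubsets (length xs)) (λ S₁ → ∑ (allSubsets (length ys)) (F S₁))
∑-allSubsets-++ []       ys F = sym (+-identityʳ _)
∑-allSubsets-++ (x ∷ xs) ys F = begin
  ∑ (allSubsets (suc (length (xs ++ ys)))) _
    ≡⟨ ∑-allSubsets-suc (length (xs ++ ys)) _ ⟩
  ∑ (allSubsets (length (xs ++ ys))) _ + ∑ (allSubsets (length (xs ++ ys))) _
    ≡⟨ cong₂ _+_ (∑-allSubsets-++ xs ys (F ∘ (true ∷_))) (∑-allSubsets-++ xs ys (F ∘ (false ∷_))) ⟩
  ∑ (allSubsets (length xs)) _ + ∑ (allSubsets (length xs)) _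
    ≡⟨ sym (∑-allSubsets-suc (length xs) _) ⟩
  ∑ (allSubsets (suc (length xs))) _ ∎

∑-allSubsets-castˢ : {A : Set} (f : A → ℕ) (xs : List A) (F : Subset (length xs) → ℕ) →
  ∑ (allSubsets (length (map f xs))) (F ∘ castˢ f xs) ≡ ∑ (allSubsets (length xs)) F
∑-allSubsets-castˢ f []       F = refl
∑-allSubsets-castˢ f (x ∷ xs) F = begin
  ∑ (allSubsets (suc (length (map f xs)))) _
    ≡⟨ ∑-allSubsets-suc (length (map f xs)) _ ⟩
  ∑ (allSubsets (length (map f xs))) _ + ∑ (allSubsets (length (map f xs))) _
    ≡⟨ cong₂ _+_ (∑-allSubsets-castˢ f xs (F ∘ (true ∷_))) (∑-allSubsets-castˢ f xs (F ∘ (false ∷_))) ⟩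
  ∑ (allSubsets (length xs)) _ + ∑ (allSubsets (length xs)) _
    ≡⟨ sym (∑-allSubsets-suc (length xs) F) ⟩
  ∑ (allSubsets (suc (length xs))) F ∎

∑-allSubsets-∣∣≡ : ∀ n k → ∑ (allSubsets n) (λ S → 𝟙 (∣ S ∣ ≟ k)) ≡ n C k
∑-allSubsets-∣∣≡ zero    zero    = refl
∑-allSubsets-∣∣≡ zero    (suc k) = refl
∑-allSubsets-∣∣≡ (suc n) zero    = begin
  ∑ (allSubsets (suc n)) (λ S → 𝟙 (∣ S ∣ ≟ 0))
    ≡⟨ ∑-allSubsets-suc n _ ⟩
  ∑ (allSubsets n) (λ S → 𝟙 (suc ∣ S ∣ ≟ 0)) + ∑ (allSubsets n) (λ S → 𝟙 (∣ S ∣ ≟ 0))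
    ≡⟨ cong₂ _+_ (∑-zero (All.universal (λ S → 𝟙-no (suc ∣ S ∣ ≟ 0) λ ()) (allSubsets n))) (∑-allSubsets-∣∣≡ n zero) ⟩
  n C 0 ∎
∑-allSubsets-∣∣≡ (suc n) (suc k) = begin
  ∑ (allSubsets (suc n)) (λ S → 𝟙 (∣ S ∣ ≟ suc k))
    ≡⟨ ∑-allSubsets-suc n _ ⟩
  ∑ (allSubsets n) (λ S → 𝟙 (suc ∣ S ∣ ≟ suc k)) + ∑ (allSubsets n) (λ S → 𝟙 (∣ S ∣ ≟ suc k))
    ≡⟨ cong₂ _+_ (trans (∑-cong (λ S → 𝟙-cong _ _ suc-injective (cong suc)) (allSubsets n)) (∑-allSubsets-∣∣≡ n k))
                 (∑-allSubsets-∣∣≡ n (suc k)) ⟩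
  n C k + n C suc k
    ≡⟨ nCk+nC[k+1]≡[n+1]C[k+1] n k ⟩
  suc n C suc k ∎

count-blockType : ∀ {K} (n m : TypeSeq K) → ∑ (allSubsets (length (degList n))) (λ S → 𝟙 (blockType n S ≟ᵗ m)) ≡ binomᵗ n m
count-blockType []       []       = refl
count-blockType (a ∷ as) (b ∷ bs) = begin
  ∑ (allSubsets (length (R ++ M))) (λ S → 𝟙 (blockType (a ∷ as) S ≟ᵗ (b ∷ bs)))
    ≡⟨ ∑-cong (λ S → trans (𝟙-cong _ ((∣ headBlock a as S ∣ ≟ b) ×-dec (blockType as (tailBlock a as S) ≟ᵗ bs))
                                    ∷-injective (λ (e₁ , e₂) → cong₂ _∷_ e₁ e₂))
                             (𝟙-× (∣ headBlock a as S ∣ ≟ b) _)) (allSubsets (length (R ++ M))) ⟩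
  ∑ (allSubsets (length (R ++ M))) (λ S → 𝟙 (∣ takeˢ R M S ∣ ≟ b) * 𝟙 (blockType as (castˢ suc D (dropˢ R M S)) ≟ᵗ bs))
    ≡⟨ ∑-allSubsets-++ R M (λ S₁ S₂ → 𝟙 (∣ S₁ ∣ ≟ b) * 𝟙 (blockType as (castˢ suc D S₂) ≟ᵗ bs)) ⟩
  ∑ (allSubsets (length R)) (λ S₁ → ∑ (allSubsets (length M)) (λ S₂ →
    𝟙 (∣ S₁ ∣ ≟ b) * 𝟙 (blockType as (castˢ suc D S₂) ≟ᵗ bs)))
    ≡⟨ ∑-product (allSubsets (length R)) (allSubsets (length M)) _ _ ⟩
  ∑ (allSubsets (length R)) (λ S₁ → 𝟙 (∣ S₁ ∣ ≟ b))
    * ∑ (allSubsets (length M)) (λ S₂ → 𝟙 (blockType as (castˢ suc D S₂) ≟ᵗ bs))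
    ≡⟨ cong₂ _*_ (trans (∑-allSubsets-∣∣≡ (length R) b) (cong (_C b) (length-replicate a)))
                 (trans (∑-allSubsets-castˢ suc D (λ S₂ → 𝟙 (blockType as S₂ ≟ᵗ bs))) (count-blockType as bs)) ⟩
  (a C b) * binomᵗ as bs ∎
  where
  R = replicate a 1
  D = degList as
  M = map suc D

-- Counting configurations with a component of type m

#holding : LocalProperty → List ℕ → ℕ
#holding Φ ds = count (sum ds) (LocalProperty.holds? Φ (vertexOfL ds))

#connected : LocalProperty → List ℕ → ℕ
#connected Φ ds = count (sum ds) (λ f → LocalProperty.holds? Φ (vertexOfL ds) f ×-dec connected? (vertexOfL ds) f)

module ComponentCount (Φ : LocalProperty) {K : ℕ} (n m : TypeSeq K) (n<2m : size n < 2 * size m) where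

  open LocalProperty Φ

  private
    ds = degList n
    L  = length ds
    N  = sum ds
    vo = vertexOfL ds

  OfType : Pred (Subset L) 0ℓ
  OfType S = typeOf n S ≡ m

  ofType? : Decidable OfType
  ofType? S = typeOf n S ≟ᵗ m

  typed : List (Subset L)
  typed = filter ofType? (allSubsets L)

  all-typed : All OfType typed
  all-typed = all-filter ofType? (allSubsets L)

  typed-unique : Unique (setoid (Subset L)) typed
  typed-unique = Uniqueₚ.filter⁺ ofType? (allSubsets-unique L)

  length-typed : length typed ≡ binomᵗ n m
  length-typed = begin
    length typed                                          ≡⟨ length-filter-∑ ofType? (allSubsets L) ⟩
    ∑ (allSubsets L) (𝟙 ∘ ofType?)
      ≡⟨ ∑-cong (λ S → 𝟙-cong _ _ (trans (sym (typeOf≡blockType n S))) (trans (typeOf≡blockType n S))) (allSubsets L) ⟩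
    ∑ (allSubsets L) (λ S → 𝟙 (blockType n S ≟ᵗ m))        ≡⟨ count-blockType n m ⟩
    binomᵗ n m ∎

  ∣∣-ofType : ∀ {S} → OfType S → ∣ S ∣ ≡ size m
  ∣∣-ofType {S} S:m = trans (sym (size-blockType n S)) (cong size (trans (sym (typeOf≡blockType n S)) S:m))

  ofType-nonempty : ∀ {S} → OfType S → ∃ (_∈ S)
  ofType-nonempty {S} S:m = nonempty S (subst (0 <_) (sym (∣∣-ofType S:m)) 0<size-m)
    where
    positive : ∀ b → size n < 2 * b → 0 < b
    positive zero    n<0 = contradiction n<0 n≮0
    positive (suc _) _   = s≤s z≤n
    0<size-m : 0 < size m
    0<size-m = positive (size m) n<2m

  ofType-meet : ∀ {S S'} → OfType S → OfType S' → ∃ λ w → w ∈ S × w ∈ S'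
  ofType-meet {S} {S'} S:m S':m = large-subsets-meet S S' (subst₂ _<_ (sym (length-degList n)) 2m≡ n<2m)
    where
    2m≡ : 2 * size m ≡ ∣ S ∣ + ∣ S' ∣
    2m≡ = trans (cong (size m +_) (+-identityʳ (size m))) (sym (cong₂ _+_ (∣∣-ofType S:m) (∣∣-ofType S':m)))

  module _ {f : Fin N → Fin N} (holds : Holds vo f) where

    private
      inv = involutive holds

    unique-typed-component : ∀ {S S'} → OfType S → OfType S' → IsComponent vo S f → IsComponent vo S' f → S ≡ S'
    unique-typed-component S:m S':m S-comp S'-comp with ofType-meet S:m S':m
    ... | w , w∈S , w∈S' =
      trans (isComponent⇒≡componentOf vo inv S-comp w∈S) (sym (isComponent⇒≡componentOf vo inv S'-comp w∈S'))

    𝟙-hasComponent : 𝟙 (hasComponentOfType? m n f) ≡ ∑ typed (λ S → 𝟙 (isComponent? vo S f))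
    𝟙-hasComponent with hasComponentOfType? m n f
    ... | yes (v , C:m) =
      sym (∑-𝟙-unique (λ S → isComponent? vo S f) typed-unique (∈-filter⁺ ofType? (∈-allSubsets _) C:m) C-comp
                      (All.map (λ S:m S-comp → unique-typed-component S:m C:m S-comp C-comp) all-typed))
      where
      C-comp : IsComponent vo (componentOf vo f v) f
      C-comp = componentOf-isComponent vo inv v
    ... | no  none =
      sym (∑-zero (All.map (λ {S} S:m → 𝟙-no (isComponent? vo S f) (λ S-comp → none (witness S:m S-comp))) all-typed))
      where
      witness : ∀ {S} → OfType S → IsComponent vo S f → ∃ λ v → typeOf n (componentOf vo f v) ≡ m
      witness {S} S:m S-comp with ofType-nonempty S:m
      ... | w , w∈S = w , trans (cong (typeOf n) (sym (isComponent⇒≡componentOf vo inv S-comp w∈S))) S:m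

  count-with-typed-component : ∀ {S} → OfType S →
    count N (λ f → holds? vo f ×-dec isComponent? vo S f) ≡ #connected Φ (degList m) * #holding Φ (degList (n -ᵗ m))
  count-with-typed-component {S} S:m = trans (Split.Count.count-split (splitting ds S) Φ)
    (cong₂ _*_ (cong (#connected Φ) inside) (cong (#holding Φ) outside))
    where
    blockType≡m : blockType n S ≡ m
    blockType≡m = trans (sym (typeOf≡blockType n S)) S:m
    inside : select ds S ≡ degList m
    inside = trans (select-degList n S) (cong degList blockType≡m)
    outside : select ds (∁ S) ≡ degList (n -ᵗ m)
    outside = trans (select-degList n (∁ S)) (cong degList (trans (blockType-∁ n S) (cong (n -ᵗ_) blockType≡m)))

  count-with-component : count N (λ f → holds? vo f ×-dec hasComponentOfType? m n f)
                       ≡ binomᵗ n m * #connected Φ (degList m) * #holding Φ (degList (n -ᵗ m))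
  count-with-component = begin
    count N (λ f → holds? vo f ×-dec hasComponentOfType? m n f)
      ≡⟨ length-filter-∑ _ (allFuns N N) ⟩
    ∑ (allFuns N N) (λ f → 𝟙 (holds? vo f ×-dec hasComponentOfType? m n f))
      ≡⟨ ∑-cong split-by-component (allFuns N N) ⟩
    ∑ (allFuns N N) (λ f → ∑ typed (λ S → 𝟙 (holds? vo f ×-dec isComponent? vo S f)))
      ≡⟨ ∑-comm (allFuns N N) typed _ ⟩
    ∑ typed (λ S → ∑ (allFuns N N) (λ f → 𝟙 (holds? vo f ×-dec isComponent? vo S f)))
      ≡⟨ ∑-cong-All (All.map (λ S:m → trans (sym (length-filter-∑ _ (allFuns N N))) (count-with-typed-component S:m))
                             all-typed) ⟩
    ∑ typed (λ _ → #connected Φ (degList m) * #holding Φ (degList (n -ᵗ m)))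
      ≡⟨ ∑-const typed _ ⟩
    length typed * (#connected Φ (degList m) * #holding Φ (degList (n -ᵗ m)))
      ≡⟨ cong (_* (#connected Φ (degList m) * #holding Φ (degList (n -ᵗ m)))) length-typed ⟩
    binomᵗ n m * (#connected Φ (degList m) * #holding Φ (degList (n -ᵗ m)))
      ≡⟨ sym (*-assoc (binomᵗ n m) _ _) ⟩
    binomᵗ n m * #connected Φ (degList m) * #holding Φ (degList (n -ᵗ m)) ∎
    where
    split-by-component : ∀ f → 𝟙 (holds? vo f ×-dec hasComponentOfType? m n f)
                             ≡ ∑ typed (λ S → 𝟙 (holds? vo f ×-dec isComponent? vo S f))
    split-by-component f = begin
      𝟙 (holds? vo f ×-dec hasComponentOfType? m n f)             ≡⟨ 𝟙-× (holds? vo f) _ ⟩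
      𝟙 (holds? vo f) * 𝟙 (hasComponentOfType? m n f)            ≡⟨ 𝟙*-cong (holds? vo f) 𝟙-hasComponent ⟩
      𝟙 (holds? vo f) * ∑ typed (λ S → 𝟙 (isComponent? vo S f))  ≡⟨ sym (∑-*ˡ (𝟙 (holds? vo f)) typed _) ⟩
      ∑ typed (λ S → 𝟙 (holds? vo f) * 𝟙 (isComponent? vo S f))  ≡⟨ sym (∑-cong (λ S → 𝟙-× (holds? vo f) _) typed) ⟩
      ∑ typed (λ S → 𝟙 (holds? vo f ×-dec isComponent? vo S f))  ∎

≗-morphism : {A W : Set} {vo : A → W} {f f' : A → A} → (∀ a → f a ≡ f' a) → GraphMorphism vo f' vo f
≗-morphism f≗f' = record { onPoints = id ; onVertices = id ; vertex-square = λ _ → refl ; edge-square = λ a → sym (f≗f' a) }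

pairings : LocalProperty
pairings = record
  { Holds      = λ _ f → IsPairing f
  ; holds?     = λ _ → pairing?
  ; Holds-cong = λ f≗f' → IsPairing-reflect (≗-morphism {vo = id} f≗f') id
  ; involutive = λ pairing p → proj₂ (pairing p)
  ; local      = Split.IsPairing-split
  }

simplePairings : LocalProperty
simplePairings = record
  { Holds      = λ vo f → IsPairing f × Simple vo f
  ; holds?     = λ vo f → pairing? f ×-dec simple? vo f
  ; Holds-cong = λ f≗f' (pairing , simple) →
      IsPairing-reflect (≗-morphism {vo = id} f≗f') id pairing , Simple-reflect (≗-morphism f≗f') id simple
  ; involutive = λ (pairing , _) p → proj₂ (pairing p)
  ; local      = λ σ d → ×-⇔ (Split.IsPairing-split σ d) (Split.Simple-split σ d)
  }
  where
  ×-⇔ : {A B C D E F : Set} → A ⇔ (B × C) → D ⇔ (E × F) → (A × D) ⇔ ((B × E) × (C × F))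
  ×-⇔ A⇔B×C D⇔E×F = mk⇔
    (λ (a , d) → let b , c = Equivalence.to A⇔B×C a ; e , f = Equivalence.to D⇔E×F d in (b , e) , (c , f))
    (λ ((b , e) , (c , f)) → Equivalence.from A⇔B×C (b , c) , Equivalence.from D⇔E×F (e , f))

corollary4p2 : ∀ {K} (n m : TypeSeq K) → m ≤ᵗ n → size n < 2 * size m →
    (#Cwith n m ≡ binomᵗ n m * #Cc m * #C (n -ᵗ m))
    × (#Swith n m ≡ binomᵗ n m * #Sc m * #S (n -ᵗ m))
corollary4p2 n m _ n<2m =
  ComponentCount.count-with-component pairings n m n<2m ,
  ComponentCount.count-with-component simplePairings n m n<2m
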